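{- For $\tilde w\in\widetilde{\underline W}^\vee$ and $\mu\in X^*(\underline T)$, we have $\tilde w\in\mathrm{Adm}^\vee(\mu)$ if and only if $\tilde w^*\in\mathrm{Adm}(\mu^*)$.
   Context: $n\ge2$, $f\ge1$. $X^*(\underline T)=(\mathbb Z^n)^f$ with components indexed by $j=0,\dots,f-1$; $W(\underline G)=S_n^f$ acting componentwise; $\widetilde{\underline W}=X^*(\underline T)\rtimes W(\underline G)$, elements written $t_\nu w$, acting on $X^*(\underline T)\otimes\mathbb R$ by $t_\nu w:x\mapsto w(x)+\nu$; $W_a=\underline\Lambda_R\rtimes W(\underline G)$ with $\underline\Lambda_R$ the root lattice. With respect to a base alcove $A$, $W_a$ is a Coxeter group generated by reflections in the walls of $A$ with Bruhat order; letting $\Omega_A$ be the stabilizer of $A$, $\widetilde{\underline W}=W_a\rtimes\Omega_A$ and $\tilde w_1\omega\le\tilde w_2\omega$ iff $\tilde w_1\le\tilde w_2$, elements of different $W_a$-cosets incomparable. $\widetilde{\underline W}$ denotes this group with the Bruhat order from the dominant base alcove $\{0<\langle x,\alpha^\vee\rangle<1\ \forall\alpha^\vee>0\}$, and $\widetilde{\underline W}^\vee$ the same group with the Bruhat order from the antidominant base alcove $\{ -1<\langle x,\alpha^\vee\rangle<0\ \forall\alpha^\vee>0\}$ (coroots $\varepsilon_i^\vee-\varepsilon_k^\vee$ in one component, positive if $i<k$; orders are componentwise). $\mathrm{Adm}(\lambda)=\{\tilde w\in\widetilde{\underline W}:\tilde w\le t_{w'(\lambda)}\text{ for some }w'\in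 W(\underline G)\}$ and $\mathrm{Adm}^\vee(\lambda)$ is defined the same way in $\widetilde{\underline W}^\vee$. The bijection $\tilde w\mapsto\tilde w^*$: for $w=(w_j)$, $w^*_j=w_{f-1-j}^{ -1}$; for $\nu=(\nu_j)$, $\nu^*_j=\nu_{f-1-j}$; for $\tilde w=wt_\nu$, $\tilde w^*=t_{\nu^*}w^*$. -}

module Defs where

open import Data.Nat as ℕ using (ℕ; suc; _∸_)
open import Data.Integer as ℤ using (ℤ; +_)
open import Data.Rational as ℚ using (ℚ; 0ℚ; 1ℚ)
open import Data.Fin as Fin using (Fin; toℕ; opposite) renaming (_<_ to _<ᶠ_)
open import Data.Fin.Permutation as P using (Permutation′; _⟨$⟩ʳ_; _⟨$⟩ˡ_; transpose; flip)
open import Data.List using (List; []; _∷_; foldr; map; length)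
open import Data.Product using (Σ; ∃; ∃-syntax; _×_; _,_)
open import Data.Bool using (if_then_else_)
open import Relation.Nullary using (¬_)
open import Relation.Nullary.Decidable using (⌊_⌋)
open import Relation.Binary.PropositionalEquality using (_≡_)

-- Choice of base alcove: the dominant one (giving W̃) or the
-- antidominant one (giving W̃^∨).
data Base : Set where
  dom antidom : Base

module _ (n f : ℕ) where

  -- characters of T: (ℤ^n)^f, components indexed by j : Fin f
  X* : Set
  X* = Fin f → Fin n → ℤ

  W : Set
  W = Fin f → Permutation′ n

  -- action of a permutation on ℤ^n:  w(ε_k) = ε_{w k}, i.e. (w x)_i = x_{w⁻¹ i}
  actℤ : Permutation′ n → (Fin n → ℤ) → (Fin n → ℤ)
  actℤ w x i = x (w ⟨$⟩ˡ i)

  actW : W → X* → X*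
  actW w ν j = actℤ (w j) (ν j)

  -- an element t_ν w of the extended affine Weyl group
  record Elt : Set where
    constructor mk
    field
      sh : X*
      pm : W
  open Elt public

  _≈_ : Elt → Elt → Set
  x ≈ y = (∀ j i → sh x j i ≡ sh y j i) × (∀ j i → pm x j ⟨$⟩ʳ i ≡ pm y j ⟨$⟩ʳ i)

  t : X* → Elt
  t ν = mk ν (λ _ → P.id)

  one : Elt
  one = t (λ _ _ → + 0)

  -- product: (t_ν w)(t_μ v) = t_{ν + w μ} (w v)
  _·_ : Elt → Elt → Elt
  x · y = mk (λ j i → sh x j i ℤ.+ actℤ (pm x j) (sh y j) i)
             (λ j → pm y j P.∘ₚ pm x j)   -- (w v)(i) = w (v i)

  Pt : Set
  Pt = Fin f → Fin n → ℚ

  act : Elt → Pt → Pt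
  act e p j i = p j (pm e j ⟨$⟩ˡ i) ℚ.+ (sh e j i ℚ./ 1)

  -- base alcoves (rational points): pairing with the positive coroot
  -- ε_a^∨ - ε_b^∨ (a < b) in component j is p j a - p j b
  InAlc : Base → Pt → Set
  InAlc dom p = ∀ j (a b : Fin n) → a <ᶠ b →
    (0ℚ ℚ.< p j a ℚ.- p j b) × (p j a ℚ.- p j b ℚ.< 1ℚ)
  InAlc antidom p = ∀ j (a b : Fin n) → a <ᶠ b →
    (ℚ.- 1ℚ ℚ.< p j a ℚ.- p j b) × (p j a ℚ.- p j b ℚ.< 0ℚ)

  InΩ : Base → Elt → Set
  InΩ A ω = ∀ p → (InAlc A p → InAlc A (act ω p)) × (InAlc A (act ω p) → InAlc A p)

  δ : Fin n → Fin n → Fin n → ℤ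
  δ a b i = (if ⌊ i Fin.≟ a ⌋ then + 1 else + 0) ℤ.- (if ⌊ i Fin.≟ b ⌋ then + 1 else + 0)

  -- affine reflection in the hyperplane ⟨x , ε_a^∨ - ε_b^∨⟩ = k of component j:
  -- x ↦ x - (⟨x,α^∨⟩ - k) α = s_α(x) + k α
  refl : Fin f → Fin n → Fin n → ℤ → Elt
  refl j a b k = mk (λ j' i → if ⌊ j' Fin.≟ j ⌋ then k ℤ.* δ a b i else + 0)
                    (λ j' → if ⌊ j' Fin.≟ j ⌋ then transpose a b else P.id)

  -- the walls of the base alcove, per component j:
  --   ⟨x, ε_a^∨ - ε_{a+1}^∨⟩ = 0, and ⟨x, ε_0^∨ - ε_{n-1}^∨⟩ = 1 (dominant) / -1 (antidominant)
  data Wall : Set where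
    inner : (j : Fin f) (a b : Fin n) → toℕ b ≡ suc (toℕ a) → Wall
    outer : (j : Fin f) (a b : Fin n) → toℕ a ≡ 0 → toℕ b ≡ n ∸ 1 → Wall

  affConst : Base → ℤ
  affConst dom = + 1
  affConst antidom = ℤ.- (+ 1)

  simple : Base → Wall → Elt
  simple A (inner j a b _) = refl j a b (+ 0)
  simple A (outer j a b _ _) = refl j a b (affConst A)

  eval : Base → List Wall → Elt
  eval A ws = foldr _·_ one (map (simple A) ws)

  InWa : Base → Elt → Set
  InWa A x = ∃[ ws ] (eval A ws ≈ x)

  HasLen : Base → Elt → ℕ → Set
  HasLen A x k = ∃[ ws ] ((length ws ≡ k) × (eval A ws ≈ x))

  Shorter : Base → Elt → Elt → Set
  Shorter A u w = ∃[ k ] (HasLen A u k × (∀ m → m ℕ.≤ k → ¬ HasLen A w m))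

  IsRefl : Base → Elt → Set
  IsRefl A r = ∃[ x ] ∃[ s ] (InWa A x × ((r · x) ≈ (x · simple A s)))

  Step : Base → Elt → Elt → Set
  Step A u w = ∃[ r ] (IsRefl A r × (w ≈ (u · r)) × Shorter A u w)

  data BruhatWa (A : Base) : Elt → Elt → Set where
    ≤-refl : ∀ {u v} → InWa A u → u ≈ v → BruhatWa A u v
    ≤-step : ∀ {u v w} → BruhatWa A u v → Step A v w → BruhatWa A u w

  Bruhat : Base → Elt → Elt → Set
  Bruhat A x y = ∃[ u ] ∃[ v ] ∃[ ω ]
    (InWa A u × InWa A v × InΩ A ω × (x ≈ (u · ω)) × (y ≈ (v · ω)) × BruhatWa A u v)

  -- Adm(λ) (A = dom) and Adm^∨(λ) (A = antidom)
  Adm : Base → X* → Elt → Set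
  Adm A λ' x = ∃[ w' ] Bruhat A x (t (actW w' λ'))

  -- ν* and w̃* : for w̃ = w t_ν, w̃* = t_{ν*} w*
  _*X : X* → X*
  (ν *X) j = ν (opposite j)

  _*W : W → W
  (w *W) j = flip (w (opposite j))

  _* : Elt → Elt
  x * = let ν = actW (λ j → flip (pm x j)) (sh x)   -- x = t_s w = w t_{w⁻¹ s}
        in mk (ν *X) (pm x *W)

-- The map w̃ ↦ w̃* is an anti-automorphism of W̃ that sends the reflection in the hyperplane
-- ⟨x, α^∨⟩ = k of component j to the reflection in ⟨x, α^∨⟩ = -k of component f-1-j, hence the
-- simple reflections of the antidominant alcove to those of the dominant one (and back).  It
-- therefore maps W_a onto W_a preserving lengths and reflections, so it is an isomorphism of the
-- Bruhat orders on W_a.  It also carries Ω_A to Ω_A' (on points it is x ↦ -x with components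
-- reversed), and for x̃ = uω one has x̃* = (ω* u* ω*⁻¹) ω*.  Since conjugation by an element of Ω
-- permutes the simple reflections it preserves the Bruhat order, and t_{w′(μ)}* = t_{w′*(μ*)}
-- finishes the argument.
--
-- The only non-formal step is that Ω normalises the simple reflections.  Testing ω = t_ν w
-- against the point (c/n)_c of the alcove shows that c ↦ ν(w c) is constant along ascents of w
-- and jumps by ±1 across descents; so w avoids the patterns 321, 132 and 213, which forces w to
-- carry adjacent pairs and the extreme pair {0, n-1} to pairs of the same kind.

module Submission where

open import Level using (0ℓ)
open import Function using (_∘_)
open import Data.Empty using (⊥; ⊥-elim)
open import Data.Product using (Σ; _×_; _,_; proj₁; proj₂)
open import Data.Sum using (_⊎_; inj₁; inj₂)
open import Data.Nat as ℕ using (ℕ; zero; suc; _≤_; z≤n; s≤s)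
import Data.Nat.Properties as ℕ
open import Data.Integer as ℤ using (ℤ; +_)
import Data.Integer.Properties as ℤ
open import Data.Integer.Solver using () renaming (module +-*-Solver to ℤ-Solver)
open import Data.Rational as ℚ using (ℚ; mkℚ; 0ℚ; 1ℚ; _/_)
import Data.Rational.Properties as ℚ
import Data.Rational.Unnormalised as ℚᵘ
import Data.Rational.Unnormalised.Properties as ℚᵘ
open import Data.Rational.Solver using () renaming (module +-*-Solver to ℚ-Solver)
open import Data.Nat.Coprimality as Coprimality using (1-coprimeTo)
open import Data.Fin as Fin using (Fin; toℕ; opposite) renaming (_<_ to _<ᶠ_)
import Data.Fin.Properties as Fin
open import Data.Fin.Permutation as P using (Permutation′; _⟨$⟩ʳ_; _⟨$⟩ˡ_; transpose; flip; inverseˡ; inverseʳ)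
import Data.Fin.Permutation.Components as PC
open import Data.List using ([]; _∷_; _++_; map; reverse)
import Data.List.Properties as List
open import Relation.Nullary using (Dec; yes; no)
open import Relation.Binary.Definitions using (Tri; tri<; tri≈; tri>)
open import Relation.Nullary.Decidable using (⌊_⌋; map′; dec-true; dec-false)
open import Data.Bool using (if_then_else_)
open import Relation.Binary.PropositionalEquality
  using (_≡_; _≢_; refl; sym; trans; cong; cong₂; subst; subst₂; module ≡-Reasoning)
open import Algebra.Bundles using (Group; AbelianGroup)
import Algebra.Properties.Group as GroupProperties
import Relation.Binary.Reasoning.Setoid as SetoidReasoning

open import Defs renaming (refl to reflection; _≈_ to _≐_; ≤-refl to bruhat-refl; ≤-step to bruhat-step)

module _ {n : ℕ} where

  ⟨$⟩ʳ-injective : (w : Permutation′ n) {a b : Fin n} → w ⟨$⟩ʳ a ≡ w ⟨$⟩ʳ b → a ≡ b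
  ⟨$⟩ʳ-injective w {a} {b} e = trans (sym (inverseˡ w)) (trans (cong (w ⟨$⟩ˡ_) e) (inverseˡ w))

  ⟨$⟩ˡ-cong : (π ρ : Permutation′ n) → (∀ i → π ⟨$⟩ʳ i ≡ ρ ⟨$⟩ʳ i) → ∀ i → π ⟨$⟩ˡ i ≡ ρ ⟨$⟩ˡ i
  ⟨$⟩ˡ-cong π ρ eq i = trans (sym (inverseˡ ρ)) (cong (ρ ⟨$⟩ˡ_) (trans (sym (eq (π ⟨$⟩ˡ i))) (inverseʳ π)))

  -- Decided through toℕ, so that a 'with' on it leaves the tests inside PC.transpose untouched.
  _≟′_ : (a b : Fin n) → Dec (a ≡ b)
  a ≟′ b = map′ Fin.toℕ-injective (cong toℕ) (toℕ a ℕ.≟ toℕ b)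

  transpose-matchˡ : (a b : Fin n) → PC.transpose a b a ≡ b
  transpose-matchˡ a b rewrite dec-true (a Fin.≟ a) refl = refl

  transpose-matchʳ : (a b : Fin n) → PC.transpose a b b ≡ a
  transpose-matchʳ a b with b Fin.≟ a
  ... | yes e = e
  ... | no ne rewrite dec-true (b Fin.≟ b) refl = refl

  transpose-mismatch : {a b k : Fin n} → k ≢ a → k ≢ b → PC.transpose a b k ≡ k
  transpose-mismatch {a} {b} {k} k≢a k≢b rewrite dec-false (k Fin.≟ a) k≢a | dec-false (k Fin.≟ b) k≢b = refl

  transpose-comm : (a b k : Fin n) → PC.transpose a b k ≡ PC.transpose b a k
  transpose-comm a b k with k ≟′ a | k ≟′ b
  ... | yes refl | yes refl = refl
  ... | yes refl | no k≢b = trans (transpose-matchˡ k b) (sym (transpose-matchʳ b k))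
  ... | no k≢a | yes refl = trans (transpose-matchʳ a k) (sym (transpose-matchˡ k a))
  ... | no k≢a | no k≢b = trans (transpose-mismatch k≢a k≢b) (sym (transpose-mismatch k≢b k≢a))

  transpose-conj : (w : Permutation′ n) (a b k : Fin n) →
    w ⟨$⟩ʳ PC.transpose a b k ≡ PC.transpose (w ⟨$⟩ʳ a) (w ⟨$⟩ʳ b) (w ⟨$⟩ʳ k)
  transpose-conj w a b k with k ≟′ a | k ≟′ b
  ... | yes refl | _ rewrite transpose-matchˡ k b | transpose-matchˡ (w ⟨$⟩ʳ k) (w ⟨$⟩ʳ b) = refl
  ... | no k≢a | yes refl rewrite transpose-matchʳ a k | transpose-matchʳ (w ⟨$⟩ʳ a) (w ⟨$⟩ʳ k) = refl
  ... | no k≢a | no k≢b rewrite transpose-mismatch k≢a k≢b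
      | transpose-mismatch {k = w ⟨$⟩ʳ k} (k≢a ∘ ⟨$⟩ʳ-injective w) (k≢b ∘ ⟨$⟩ʳ-injective w) = refl

  -- δ n f a b i unfolds to indicator i a - indicator i b.
  indicator : Fin n → Fin n → ℤ
  indicator i a = if ⌊ i Fin.≟ a ⌋ then + 1 else + 0

  indicator-≡ : (a : Fin n) → indicator a a ≡ + 1
  indicator-≡ a with a Fin.≟ a
  ... | yes _ = refl
  ... | no a≢a = ⊥-elim (a≢a refl)

  indicator-≢ : {a b : Fin n} → a ≢ b → indicator a b ≡ + 0
  indicator-≢ {a} {b} a≢b with a Fin.≟ b
  ... | yes a≡b = ⊥-elim (a≢b a≡b)
  ... | no _ = refl

  indicator-conj : (w : Permutation′ n) (a i : Fin n) → indicator (w ⟨$⟩ˡ i) a ≡ indicator i (w ⟨$⟩ʳ a)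
  indicator-conj w a i with w ⟨$⟩ˡ i Fin.≟ a | i Fin.≟ w ⟨$⟩ʳ a
  ... | yes _ | yes _ = refl
  ... | yes e | no ne = ⊥-elim (ne (trans (sym (inverseʳ w)) (cong (w ⟨$⟩ʳ_) e)))
  ... | no ne | yes e = ⊥-elim (ne (trans (cong (w ⟨$⟩ˡ_) e) (inverseˡ w)))
  ... | no _ | no _ = refl

dual : Base → Base
dual dom = antidom
dual antidom = dom

dual-involutive : ∀ A → dual (dual A) ≡ A
dual-involutive dom = refl
dual-involutive antidom = refl

-- The group W̃, its affine reflections and the anti-involution *

module Affine (n f : ℕ) where

  infix 4 _≃_
  record _≃_ (x y : Elt n f) : Set where
    constructor ≃⁺
    field
      sh-≡ : ∀ j i → sh x j i ≡ sh y j i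
      pm-≡ : ∀ j i → pm x j ⟨$⟩ʳ i ≡ pm y j ⟨$⟩ʳ i
  open _≃_ public

  ≐⇒≃ : ∀ x y → _≐_ n f x y → x ≃ y
  ≐⇒≃ x y (eq-sh , eq-pm) = ≃⁺ eq-sh eq-pm

  ≃⇒≐ : ∀ {x y} → x ≃ y → _≐_ n f x y
  ≃⇒≐ (≃⁺ eq-sh eq-pm) = eq-sh , eq-pm

  ≃-reflexive : ∀ {x y} → x ≡ y → x ≃ y
  ≃-reflexive refl = ≃⁺ (λ _ _ → refl) (λ _ _ → refl)

  ≃-sym : ∀ {x y} → x ≃ y → y ≃ x
  ≃-sym (≃⁺ a b) = ≃⁺ (λ j i → sym (a j i)) (λ j i → sym (b j i))

  ≃-trans : ∀ {x y z} → x ≃ y → y ≃ z → x ≃ z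
  ≃-trans (≃⁺ a b) (≃⁺ c d) = ≃⁺ (λ j i → trans (a j i) (c j i)) (λ j i → trans (b j i) (d j i))

  pm-≡ˡ : ∀ {x y} → x ≃ y → ∀ j i → pm x j ⟨$⟩ˡ i ≡ pm y j ⟨$⟩ˡ i
  pm-≡ˡ {x} {y} x≃y j = ⟨$⟩ˡ-cong (pm x j) (pm y j) (pm-≡ x≃y j)

  infixl 7 _∙_
  _∙_ : Elt n f → Elt n f → Elt n f
  _∙_ = _·_ n f

  ε : Elt n f
  ε = one n f

  infix 8 _⁻¹
  _⁻¹ : Elt n f → Elt n f
  x ⁻¹ = mk (λ j i → ℤ.- sh x j (pm x j ⟨$⟩ʳ i)) (λ j → flip (pm x j))

  ∙-cong : ∀ {x x′ y y′} → x ≃ x′ → y ≃ y′ → x ∙ y ≃ x′ ∙ y′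
  ∙-cong {x} {x′} {y} x≃x′ y≃y′ = ≃⁺
    (λ j i → cong₂ ℤ._+_ (sh-≡ x≃x′ j i) (trans (cong (sh y j) (pm-≡ˡ x≃x′ j i)) (sh-≡ y≃y′ j _)))
    (λ j i → trans (cong (pm x j ⟨$⟩ʳ_) (pm-≡ y≃y′ j i)) (pm-≡ x≃x′ j _))

  ∙-assoc : ∀ x y z → (x ∙ y) ∙ z ≃ x ∙ (y ∙ z)
  ∙-assoc x y z = ≃⁺ (λ j i → ℤ.+-assoc (sh x j i) _ _) (λ _ _ → refl)

  ∙-identityˡ : ∀ x → ε ∙ x ≃ x
  ∙-identityˡ x = ≃⁺ (λ _ _ → ℤ.+-identityˡ _) (λ _ _ → refl)

  ∙-identityʳ : ∀ x → x ∙ ε ≃ x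
  ∙-identityʳ x = ≃⁺ (λ _ _ → ℤ.+-identityʳ _) (λ _ _ → refl)

  ∙-inverseˡ : ∀ x → x ⁻¹ ∙ x ≃ ε
  ∙-inverseˡ x = ≃⁺ (λ j i → ℤ.+-inverseˡ (sh x j (pm x j ⟨$⟩ʳ i))) (λ j i → inverseˡ (pm x j))

  ∙-inverseʳ : ∀ x → x ∙ x ⁻¹ ≃ ε
  ∙-inverseʳ x = ≃⁺ (λ j i → trans (cong (λ k → sh x j i ℤ.+ ℤ.- sh x j k) (inverseʳ (pm x j))) (ℤ.+-inverseʳ (sh x j i)))
                    (λ j i → inverseʳ (pm x j))

  ⁻¹-cong : ∀ {x y} → x ≃ y → x ⁻¹ ≃ y ⁻¹
  ⁻¹-cong {x} x≃y = ≃⁺ (λ j i → cong ℤ.-_ (trans (cong (sh x j) (pm-≡ x≃y j i)) (sh-≡ x≃y j _))) (pm-≡ˡ x≃y)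

  ∙-congˡ : ∀ x {y y′} → y ≃ y′ → x ∙ y ≃ x ∙ y′
  ∙-congˡ x = ∙-cong (≃-reflexive {x} refl)

  ∙-congʳ : ∀ {x x′} y → x ≃ x′ → x ∙ y ≃ x′ ∙ y
  ∙-congʳ y x≃x′ = ∙-cong x≃x′ (≃-reflexive {y} refl)

  W̃ : Group 0ℓ 0ℓ
  W̃ = record
    { Carrier = Elt n f ; _≈_ = _≃_ ; _∙_ = _∙_ ; ε = ε ; _⁻¹ = _⁻¹
    ; isGroup = record
      { isMonoid = record
        { isSemigroup = record
          { isMagma = record
            { isEquivalence = record { refl = ≃-reflexive refl ; sym = ≃-sym ; trans = ≃-trans }
            ; ∙-cong = ∙-cong }
          ; assoc = ∙-assoc }
        ; identity = ∙-identityˡ , ∙-identityʳ }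
      ; inverse = ∙-inverseˡ , ∙-inverseʳ
      ; ⁻¹-cong = ⁻¹-cong } }

  open Group W̃ public using () renaming (setoid to W̃-setoid)
  open GroupProperties W̃ public using (⁻¹-involutive; ⁻¹-anti-homo-∙; ε⁻¹≈ε; \\-leftDividesˡ; \\-leftDividesʳ; //-rightDividesˡ; //-rightDividesʳ)

  δ-transpose : (a b k : Fin n) → δ n f a b (PC.transpose a b k) ≡ ℤ.- δ n f a b k
  δ-transpose a b k with k ≟′ a | k ≟′ b
  ... | yes refl | yes refl rewrite transpose-matchˡ k k | indicator-≡ k = refl
  ... | yes refl | no k≢b rewrite transpose-matchˡ k b | indicator-≡ b | indicator-≢ k≢b | indicator-≡ k
                                | indicator-≢ (k≢b ∘ sym) = refl
  ... | no k≢a | yes refl rewrite transpose-matchʳ a k | indicator-≡ a | indicator-≢ k≢a | indicator-≡ k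
                                | indicator-≢ (k≢a ∘ sym) = refl
  ... | no k≢a | no k≢b rewrite transpose-mismatch k≢a k≢b | indicator-≢ k≢a | indicator-≢ k≢b = refl

  δ-conj : (w : Permutation′ n) (a b i : Fin n) → δ n f a b (w ⟨$⟩ˡ i) ≡ δ n f (w ⟨$⟩ʳ a) (w ⟨$⟩ʳ b) i
  δ-conj w a b i = cong₂ ℤ._-_ (indicator-conj w a i) (indicator-conj w b i)

  module _ {j : Fin f} (a b : Fin n) (k : ℤ) {j′ : Fin f} where

    sh-reflection-on : j′ ≡ j → ∀ i → sh (reflection n f j a b k) j′ i ≡ k ℤ.* δ n f a b i
    sh-reflection-on j′≡j i with j′ Fin.≟ j
    ... | yes _ = refl
    ... | no j′≢j = ⊥-elim (j′≢j j′≡j)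

    sh-reflection-off : j′ ≢ j → ∀ i → sh (reflection n f j a b k) j′ i ≡ + 0
    sh-reflection-off j′≢j i with j′ Fin.≟ j
    ... | yes j′≡j = ⊥-elim (j′≢j j′≡j)
    ... | no _ = refl

    pm-reflection-on : j′ ≡ j → pm (reflection n f j a b k) j′ ≡ transpose a b
    pm-reflection-on j′≡j with j′ Fin.≟ j
    ... | yes _ = refl
    ... | no j′≢j = ⊥-elim (j′≢j j′≡j)

    pm-reflection-off : j′ ≢ j → pm (reflection n f j a b k) j′ ≡ P.id
    pm-reflection-off j′≢j with j′ Fin.≟ j
    ... | yes j′≡j = ⊥-elim (j′≢j j′≡j)
    ... | no _ = refl

  reflection-involutive : ∀ j a b k → reflection n f j a b k ⁻¹ ≃ reflection n f j a b k
  reflection-involutive j a b k = ≃⁺ sh-eq pm-eq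
    where
    s = reflection n f j a b k
    sh-eq : ∀ j′ i → ℤ.- sh s j′ (pm s j′ ⟨$⟩ʳ i) ≡ sh s j′ i
    sh-eq j′ i with j′ ≟′ j
    ... | yes j′≡j = begin
      ℤ.- sh s j′ (pm s j′ ⟨$⟩ʳ i)          ≡⟨ cong (λ π → ℤ.- sh s j′ (π ⟨$⟩ʳ i)) (pm-reflection-on a b k j′≡j) ⟩
      ℤ.- sh s j′ (PC.transpose a b i)      ≡⟨ cong ℤ.-_ (sh-reflection-on a b k j′≡j (PC.transpose a b i)) ⟩
      ℤ.- (k ℤ.* δ n f a b (PC.transpose a b i)) ≡⟨ cong (λ d → ℤ.- (k ℤ.* d)) (δ-transpose a b i) ⟩
      ℤ.- (k ℤ.* ℤ.- δ n f a b i)           ≡⟨ cong ℤ.-_ (sym (ℤ.neg-distribʳ-* k _)) ⟩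
      ℤ.- ℤ.- (k ℤ.* δ n f a b i)           ≡⟨ ℤ.neg-involutive _ ⟩
      k ℤ.* δ n f a b i                     ≡⟨ sym (sh-reflection-on a b k j′≡j i) ⟩
      sh s j′ i                             ∎
      where open ≡-Reasoning
    ... | no j′≢j = trans (cong (λ π → ℤ.- sh s j′ (π ⟨$⟩ʳ i)) (pm-reflection-off a b k j′≢j))
                      (trans (cong ℤ.-_ (sh-reflection-off a b k j′≢j i)) (sym (sh-reflection-off a b k j′≢j i)))
    pm-eq : ∀ j′ i → pm s j′ ⟨$⟩ˡ i ≡ pm s j′ ⟨$⟩ʳ i
    pm-eq j′ i with j′ ≟′ j
    ... | yes j′≡j rewrite pm-reflection-on a b k j′≡j = sym (transpose-comm a b i)
    ... | no j′≢j rewrite pm-reflection-off a b k j′≢j = refl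

  reflection-swap : ∀ j a b k → reflection n f j a b k ≃ reflection n f j b a (ℤ.- k)
  reflection-swap j a b k = ≃⁺ sh-eq pm-eq
    where
    sh-eq : ∀ j′ i → sh (reflection n f j a b k) j′ i ≡ sh (reflection n f j b a (ℤ.- k)) j′ i
    sh-eq j′ i with j′ ≟′ j
    ... | yes j′≡j rewrite sh-reflection-on a b k j′≡j i | sh-reflection-on b a (ℤ.- k) j′≡j i =
      solve 3 (λ z x y → z :* (x :- y) := (:- z) :* (y :- x)) refl k (indicator i a) (indicator i b)
      where open ℤ-Solver
    ... | no j′≢j rewrite sh-reflection-off a b k j′≢j i | sh-reflection-off b a (ℤ.- k) j′≢j i = refl
    pm-eq : ∀ j′ i → pm (reflection n f j a b k) j′ ⟨$⟩ʳ i ≡ pm (reflection n f j b a (ℤ.- k)) j′ ⟨$⟩ʳ i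
    pm-eq j′ i with j′ ≟′ j
    ... | yes j′≡j rewrite pm-reflection-on a b k j′≡j | pm-reflection-on b a (ℤ.- k) j′≡j = transpose-comm a b i
    ... | no j′≢j rewrite pm-reflection-off a b k j′≢j | pm-reflection-off b a (ℤ.- k) j′≢j = refl

  reflection-conj : ∀ g j a b k → a ≢ b →
    let w = pm g j ; ν = sh g j in
    g ∙ reflection n f j a b k ≃
    reflection n f j (w ⟨$⟩ʳ a) (w ⟨$⟩ʳ b) (k ℤ.+ ν (w ⟨$⟩ʳ a) ℤ.- ν (w ⟨$⟩ʳ b)) ∙ g
  reflection-conj g j a b k a≢b = ≃⁺ sh-eq pm-eq
    where
    w = pm g j
    ν = sh g j
    A = w ⟨$⟩ʳ a
    B = w ⟨$⟩ʳ b
    k′ = k ℤ.+ ν A ℤ.- ν B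
    A≢B : A ≢ B
    A≢B = a≢b ∘ ⟨$⟩ʳ-injective w
    open ℤ-Solver
    sh-eq : ∀ j′ i → sh g j′ i ℤ.+ sh (reflection n f j a b k) j′ (pm g j′ ⟨$⟩ˡ i) ≡
                     sh (reflection n f j A B k′) j′ i ℤ.+ sh g j′ (pm (reflection n f j A B k′) j′ ⟨$⟩ˡ i)
    sh-eq j′ i with j′ ≟′ j
    ... | no j′≢j rewrite sh-reflection-off a b k j′≢j (pm g j′ ⟨$⟩ˡ i) | sh-reflection-off A B k′ j′≢j i
                        | pm-reflection-off A B k′ j′≢j =
      trans (ℤ.+-identityʳ (sh g j′ i)) (sym (ℤ.+-identityˡ (sh g j′ i)))
    ... | yes refl rewrite sh-reflection-on {j} a b k {j} refl (w ⟨$⟩ˡ i) | sh-reflection-on {j} A B k′ {j} refl i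
                         | pm-reflection-on {j} A B k′ {j} refl | δ-conj w a b i with i ≟′ A | i ≟′ B
    ...   | yes refl | _ rewrite indicator-≡ A | indicator-≢ A≢B | transpose-matchʳ B A =
      solve 3 (λ x y z → x :+ z :* con (+ 1) := (z :+ x :- y) :* con (+ 1) :+ y) refl (ν A) (ν B) k
    ...   | no i≢A | yes refl rewrite indicator-≡ B | indicator-≢ (A≢B ∘ sym) | transpose-matchˡ B A =
      solve 3 (λ x y z → y :+ z :* con (ℤ.- + 1) := (z :+ x :- y) :* con (ℤ.- + 1) :+ x) refl (ν A) (ν B) k
    ...   | no i≢A | no i≢B rewrite indicator-≢ i≢A | indicator-≢ i≢B | transpose-mismatch i≢B i≢A =
      solve 3 (λ x z z′ → x :+ z :* con (+ 0) := z′ :* con (+ 0) :+ x) refl (ν i) k k′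
    pm-eq : ∀ j′ i → pm g j′ ⟨$⟩ʳ (pm (reflection n f j a b k) j′ ⟨$⟩ʳ i) ≡
                     pm (reflection n f j A B k′) j′ ⟨$⟩ʳ (pm g j′ ⟨$⟩ʳ i)
    pm-eq j′ i with j′ ≟′ j
    ... | yes refl rewrite pm-reflection-on {j} a b k {j} refl | pm-reflection-on {j} A B k′ {j} refl = transpose-conj w a b i
    ... | no j′≢j rewrite pm-reflection-off a b k j′≢j | pm-reflection-off A B k′ j′≢j = refl

  reflection-conj-ascent : ∀ g j a b k → a ≢ b → sh g j (pm g j ⟨$⟩ʳ a) ≡ sh g j (pm g j ⟨$⟩ʳ b) →
    g ∙ reflection n f j a b k ≃ reflection n f j (pm g j ⟨$⟩ʳ a) (pm g j ⟨$⟩ʳ b) k ∙ g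
  reflection-conj-ascent g j a b k a≢b same = ≃-trans (reflection-conj g j a b k a≢b)
    (∙-congʳ g (≃-reflexive (cong (reflection n f j _ _) k′≡k)))
    where
    open ℤ-Solver
    k′≡k : k ℤ.+ sh g j (pm g j ⟨$⟩ʳ a) ℤ.- sh g j (pm g j ⟨$⟩ʳ b) ≡ k
    k′≡k rewrite same = solve 2 (λ k x → k :+ x :- x := k) refl k (sh g j (pm g j ⟨$⟩ʳ b))

  reflection-conj-descent : ∀ g j a b k e k′ → e ℤ.- k ≡ k′ → a ≢ b →
    sh g j (pm g j ⟨$⟩ʳ b) ≡ sh g j (pm g j ⟨$⟩ʳ a) ℤ.+ e →
    g ∙ reflection n f j a b k ≃ reflection n f j (pm g j ⟨$⟩ʳ b) (pm g j ⟨$⟩ʳ a) k′ ∙ g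
  reflection-conj-descent g j a b k e k′ e-k≡k′ a≢b shifted = ≃-trans (reflection-conj g j a b k a≢b)
    (∙-congʳ g (≃-trans (reflection-swap j _ _ (k ℤ.+ sh g j (pm g j ⟨$⟩ʳ a) ℤ.- sh g j (pm g j ⟨$⟩ʳ b)))
                        (≃-reflexive (cong (reflection n f j _ _) (trans k″≡ e-k≡k′)))))
    where
    open ℤ-Solver
    k″≡ : ℤ.- (k ℤ.+ sh g j (pm g j ⟨$⟩ʳ a) ℤ.- sh g j (pm g j ⟨$⟩ʳ b)) ≡ e ℤ.- k
    k″≡ rewrite shifted = solve 3 (λ k x e → :- (k :+ x :- (x :+ e)) := e :- k) refl k (sh g j (pm g j ⟨$⟩ʳ a)) e

  infix 9 _⋆ _*ˣ
  _⋆ : Elt n f → Elt n f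
  _⋆ = _* n f

  _*ˣ : X* n f → X* n f
  _*ˣ = _*X n f

  ⋆-cong : ∀ {x y} → x ≃ y → x ⋆ ≃ y ⋆
  ⋆-cong {x} {y} x≃y = ≃⁺
    (λ j i → trans (cong (sh x (opposite j)) (pm-≡ x≃y (opposite j) i)) (sh-≡ x≃y (opposite j) _))
    (λ j → pm-≡ˡ x≃y (opposite j))

  ⋆-anti-homo : ∀ x y → (x ∙ y) ⋆ ≃ y ⋆ ∙ x ⋆
  ⋆-anti-homo x y = ≃⁺ (λ j i → sh-eq (opposite j) i) (λ _ _ → refl)
    where
    sh-eq : ∀ j i → let u = pm x j ⟨$⟩ʳ (pm y j ⟨$⟩ʳ i) in
      sh x j u ℤ.+ sh y j (pm x j ⟨$⟩ˡ u) ≡ sh y j (pm y j ⟨$⟩ʳ i) ℤ.+ sh x j u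
    sh-eq j i = trans (cong (λ v → sh x j u ℤ.+ sh y j v) (inverseˡ (pm x j))) (ℤ.+-comm (sh x j u) _)
      where u = pm x j ⟨$⟩ʳ (pm y j ⟨$⟩ʳ i)

  ⋆-involutive : ∀ x → x ⋆ ⋆ ≃ x
  ⋆-involutive x = ≃⁺
    (λ j i → trans (cong (sh x (opposite (opposite j))) (inverseʳ (pm x (opposite (opposite j)))))
                   (cong (λ j′ → sh x j′ i) (Fin.opposite-involutive j)))
    (λ j i → cong (λ j′ → pm x j′ ⟨$⟩ʳ i) (Fin.opposite-involutive j))

  ⋆-reflection : ∀ j a b k → reflection n f j a b k ⋆ ≃ reflection n f (opposite j) a b (ℤ.- k)
  ⋆-reflection j a b k = ≃⁺ sh-eq pm-eq
    where
    s = reflection n f j a b k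
    oo⇒ : ∀ {j′} → opposite j′ ≡ j → j′ ≡ opposite j
    oo⇒ {j′} e = trans (sym (Fin.opposite-involutive j′)) (cong opposite e)
    sh-eq : ∀ j′ i → sh s (opposite j′) (pm s (opposite j′) ⟨$⟩ʳ i) ≡ sh (reflection n f (opposite j) a b (ℤ.- k)) j′ i
    sh-eq j′ i with opposite j′ ≟′ j
    ... | yes e = begin
      sh s (opposite j′) (pm s (opposite j′) ⟨$⟩ʳ i) ≡⟨ cong (λ π → sh s (opposite j′) (π ⟨$⟩ʳ i)) (pm-reflection-on a b k e) ⟩
      sh s (opposite j′) (PC.transpose a b i)        ≡⟨ sh-reflection-on a b k e (PC.transpose a b i) ⟩
      k ℤ.* δ n f a b (PC.transpose a b i)           ≡⟨ cong (k ℤ.*_) (δ-transpose a b i) ⟩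
      k ℤ.* ℤ.- δ n f a b i                          ≡⟨ sym (ℤ.neg-distribʳ-* k _) ⟩
      ℤ.- (k ℤ.* δ n f a b i)                        ≡⟨ ℤ.neg-distribˡ-* k _ ⟩
      ℤ.- k ℤ.* δ n f a b i                          ≡⟨ sym (sh-reflection-on a b (ℤ.- k) (oo⇒ e) i) ⟩
      sh (reflection n f (opposite j) a b (ℤ.- k)) j′ i ∎
      where open ≡-Reasoning
    ... | no ne = trans (cong (λ π → sh s (opposite j′) (π ⟨$⟩ʳ i)) (pm-reflection-off a b k ne))
                    (trans (sh-reflection-off a b k ne i)
                           (sym (sh-reflection-off a b (ℤ.- k) (λ e → ne (trans (cong opposite e) (Fin.opposite-involutive j))) i)))
    pm-eq : ∀ j′ i → pm s (opposite j′) ⟨$⟩ˡ i ≡ pm (reflection n f (opposite j) a b (ℤ.- k)) j′ ⟨$⟩ʳ i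
    pm-eq j′ i with opposite j′ ≟′ j
    ... | yes e rewrite pm-reflection-on a b k e | pm-reflection-on a b (ℤ.- k) (oo⇒ e) = sym (transpose-comm a b i)
    ... | no ne rewrite pm-reflection-off a b k ne
                      | pm-reflection-off a b (ℤ.- k) (λ e → ne (trans (cong opposite e) (Fin.opposite-involutive j))) = refl

  affConst-dual : ∀ A → ℤ.- affConst n f A ≡ affConst n f (dual A)
  affConst-dual dom = refl
  affConst-dual antidom = refl

  mirrorWall : Wall n f → Wall n f
  mirrorWall (inner j a b adj) = inner (opposite j) a b adj
  mirrorWall (outer j a b a≡0 b≡n-1) = outer (opposite j) a b a≡0 b≡n-1

  simple-involutive : ∀ A s → simple n f A s ⁻¹ ≃ simple n f A s
  simple-involutive A (inner j a b _) = reflection-involutive j a b (+ 0)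
  simple-involutive A (outer j a b _ _) = reflection-involutive j a b (affConst n f A)

  ⋆-simple : ∀ A s → simple n f A s ⋆ ≃ simple n f (dual A) (mirrorWall s)
  ⋆-simple A (inner j a b _) = ⋆-reflection j a b (+ 0)
  ⋆-simple A (outer j a b _ _) rewrite sym (affConst-dual A) = ⋆-reflection j a b (affConst n f A)

  eval-++ : ∀ A ws vs → eval n f A (ws ++ vs) ≃ eval n f A ws ∙ eval n f A vs
  eval-++ A [] vs = ≃-sym (∙-identityˡ (eval n f A vs))
  eval-++ A (s ∷ ws) vs = begin
    simple n f A s ∙ eval n f A (ws ++ vs)               ≈⟨ ∙-congˡ (simple n f A s) (eval-++ A ws vs) ⟩
    simple n f A s ∙ (eval n f A ws ∙ eval n f A vs)     ≈⟨ ≃-sym (∙-assoc (simple n f A s) (eval n f A ws) (eval n f A vs)) ⟩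
    simple n f A s ∙ eval n f A ws ∙ eval n f A vs       ∎
    where open SetoidReasoning W̃-setoid

  InWa-resp : ∀ A {x y} → x ≃ y → InWa n f A x → InWa n f A y
  InWa-resp A {x} x≃y (ws , ws≐x) = ws , ≃⇒≐ (≃-trans (≐⇒≃ (eval n f A ws) x ws≐x) x≃y)

  HasLen-resp : ∀ A {x y} ℓ → x ≃ y → HasLen n f A x ℓ → HasLen n f A y ℓ
  HasLen-resp A {x} ℓ x≃y (ws , len , ws≐x) = ws , len , ≃⇒≐ (≃-trans (≐⇒≃ (eval n f A ws) x ws≐x) x≃y)

  InWa-simple : ∀ A s → InWa n f A (simple n f A s)
  InWa-simple A s = s ∷ [] , ≃⇒≐ (∙-identityʳ (simple n f A s))

  InWa-∙ : ∀ A x y → InWa n f A x → InWa n f A y → InWa n f A (x ∙ y)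
  InWa-∙ A x y (ws , ws≐x) (vs , vs≐y) =
    ws ++ vs , ≃⇒≐ (≃-trans (eval-++ A ws vs) (∙-cong (≐⇒≃ (eval n f A ws) x ws≐x) (≐⇒≃ (eval n f A vs) y vs≐y)))

  module SimpleHom (F : Elt n f → Elt n f) (F-cong : ∀ {x y} → x ≃ y → F x ≃ F y)
                   (F-homo : ∀ x y → F (x ∙ y) ≃ F x ∙ F y) (F-ε : F ε ≃ ε)
                   (A B : Base) (τ : Wall n f → Wall n f) (F-simple : ∀ s → F (simple n f A s) ≃ simple n f B (τ s)) where

    F-eval : ∀ ws → F (eval n f A ws) ≃ eval n f B (map τ ws)
    F-eval [] = F-ε
    F-eval (s ∷ ws) = ≃-trans (F-homo _ _) (∙-cong (F-simple s) (F-eval ws))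

    F-InWa : ∀ x → InWa n f A x → InWa n f B (F x)
    F-InWa x (ws , ws≐x) = map τ ws , ≃⇒≐ (≃-trans (≃-sym (F-eval ws)) (F-cong (≐⇒≃ (eval n f A ws) x ws≐x)))

    F-HasLen : ∀ x ℓ → HasLen n f A x ℓ → HasLen n f B (F x) ℓ
    F-HasLen x ℓ (ws , len , ws≐x) =
      map τ ws , trans (List.length-map τ ws) len , ≃⇒≐ (≃-trans (≃-sym (F-eval ws)) (F-cong (≐⇒≃ (eval n f A ws) x ws≐x)))

    F-IsRefl : ∀ r → IsRefl n f A r → IsRefl n f B (F r)
    F-IsRefl r (x , s , x∈Wa , rx≐xs) = F x , τ s , F-InWa x x∈Wa , ≃⇒≐ (begin
      F r ∙ F x              ≈⟨ ≃-sym (F-homo r x) ⟩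
      F (r ∙ x)              ≈⟨ F-cong (≐⇒≃ (r ∙ x) (x ∙ simple n f A s) rx≐xs) ⟩
      F (x ∙ simple n f A s) ≈⟨ F-homo x (simple n f A s) ⟩
      F x ∙ F (simple n f A s) ≈⟨ ∙-congˡ (F x) (F-simple s) ⟩
      F x ∙ simple n f B (τ s) ∎)
      where open SetoidReasoning W̃-setoid

  module SimpleAntiHom (F : Elt n f → Elt n f) (F-cong : ∀ {x y} → x ≃ y → F x ≃ F y)
                       (F-anti-homo : ∀ x y → F (x ∙ y) ≃ F y ∙ F x) (F-ε : F ε ≃ ε)
                       (A B : Base) (τ : Wall n f → Wall n f) (F-simple : ∀ s → F (simple n f A s) ≃ simple n f B (τ s)) where

    F-eval : ∀ ws → F (eval n f A ws) ≃ eval n f B (reverse (map τ ws))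
    F-eval [] = F-ε
    F-eval (s ∷ ws) rewrite List.unfold-reverse (τ s) (map τ ws) = begin
      F (simple n f A s ∙ eval n f A ws)                       ≈⟨ F-anti-homo (simple n f A s) (eval n f A ws) ⟩
      F (eval n f A ws) ∙ F (simple n f A s)                   ≈⟨ ∙-cong (F-eval ws) (≃-trans (F-simple s) (≃-sym (∙-identityʳ _))) ⟩
      eval n f B (reverse (map τ ws)) ∙ eval n f B (τ s ∷ [])  ≈⟨ ≃-sym (eval-++ B (reverse (map τ ws)) (τ s ∷ [])) ⟩
      eval n f B (reverse (map τ ws) ++ τ s ∷ [])              ∎
      where open SetoidReasoning W̃-setoid

    F-InWa : ∀ x → InWa n f A x → InWa n f B (F x)
    F-InWa x (ws , ws≐x) = reverse (map τ ws) , ≃⇒≐ (≃-trans (≃-sym (F-eval ws)) (F-cong (≐⇒≃ (eval n f A ws) x ws≐x)))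

    F-HasLen : ∀ x ℓ → HasLen n f A x ℓ → HasLen n f B (F x) ℓ
    F-HasLen x ℓ (ws , len , ws≐x) =
      reverse (map τ ws) , trans (List.length-reverse (map τ ws)) (trans (List.length-map τ ws) len) ,
      ≃⇒≐ (≃-trans (≃-sym (F-eval ws)) (F-cong (≐⇒≃ (eval n f A ws) x ws≐x)))

  module Inverse (A : Base) = SimpleAntiHom _⁻¹ ⁻¹-cong ⁻¹-anti-homo-∙ ε⁻¹≈ε A A (λ s → s) (simple-involutive A)
  module Star (A : Base) = SimpleAntiHom _⋆ ⋆-cong ⋆-anti-homo (≃-reflexive refl) A (dual A) mirrorWall (⋆-simple A)

  intertwine-⁻¹ : ∀ a b c → a ∙ b ≃ c ∙ a → b ∙ a ⁻¹ ≃ a ⁻¹ ∙ c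
  intertwine-⁻¹ a b c ab≃ca = begin
    b ∙ a ⁻¹                  ≈⟨ ≃-sym (\\-leftDividesʳ a (b ∙ a ⁻¹)) ⟩
    a ⁻¹ ∙ (a ∙ (b ∙ a ⁻¹))   ≈⟨ ∙-congˡ (a ⁻¹) (≃-sym (∙-assoc a b (a ⁻¹))) ⟩
    a ⁻¹ ∙ (a ∙ b ∙ a ⁻¹)     ≈⟨ ∙-congˡ (a ⁻¹) (∙-congʳ (a ⁻¹) ab≃ca) ⟩
    a ⁻¹ ∙ (c ∙ a ∙ a ⁻¹)     ≈⟨ ∙-congˡ (a ⁻¹) (//-rightDividesʳ a c) ⟩
    a ⁻¹ ∙ c                  ∎
    where open SetoidReasoning W̃-setoid

  IsRefl⇒InWa : ∀ A r → IsRefl n f A r → InWa n f A r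
  IsRefl⇒InWa A r (x , s , x∈Wa , rx≐xs) =
    InWa-resp A r≃xsx⁻¹ (InWa-∙ A (x ∙ simple n f A s) (x ⁻¹) (InWa-∙ A x (simple n f A s) x∈Wa (InWa-simple A s)) (Inverse.F-InWa A x x∈Wa))
    where
    r≃xsx⁻¹ : x ∙ simple n f A s ∙ x ⁻¹ ≃ r
    r≃xsx⁻¹ = ≃-sym (≃-trans (≃-sym (//-rightDividesʳ x r)) (∙-congʳ (x ⁻¹) (≐⇒≃ (r ∙ x) (x ∙ simple n f A s) rx≐xs)))

  IsRefl-conj : ∀ A r v → InWa n f A v → IsRefl n f A r → IsRefl n f A (v ⁻¹ ∙ r ∙ v)
  IsRefl-conj A r v v∈Wa (x , s , x∈Wa , rx≐xs) = v ⁻¹ ∙ x , s , InWa-∙ A (v ⁻¹) x (Inverse.F-InWa A v v∈Wa) x∈Wa , ≃⇒≐ (begin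
    v ⁻¹ ∙ r ∙ v ∙ (v ⁻¹ ∙ x)  ≈⟨ ∙-assoc (v ⁻¹ ∙ r) v (v ⁻¹ ∙ x) ⟩
    v ⁻¹ ∙ r ∙ (v ∙ (v ⁻¹ ∙ x)) ≈⟨ ∙-congˡ (v ⁻¹ ∙ r) (\\-leftDividesˡ v x) ⟩
    v ⁻¹ ∙ r ∙ x               ≈⟨ ∙-assoc (v ⁻¹) r x ⟩
    v ⁻¹ ∙ (r ∙ x)             ≈⟨ ∙-congˡ (v ⁻¹) (≐⇒≃ (r ∙ x) (x ∙ simple n f A s) rx≐xs) ⟩
    v ⁻¹ ∙ (x ∙ simple n f A s) ≈⟨ ≃-sym (∙-assoc (v ⁻¹) x (simple n f A s)) ⟩
    v ⁻¹ ∙ x ∙ simple n f A s  ∎)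
    where open SetoidReasoning W̃-setoid

  IsRefl-⋆ : ∀ A r → IsRefl n f A r → IsRefl n f (dual A) (r ⋆)
  IsRefl-⋆ A r (x , s , x∈Wa , rx≐xs) =
    x ⋆ ⁻¹ , mirrorWall s , Inverse.F-InWa (dual A) (x ⋆) (Star.F-InWa A x x∈Wa) ,
    ≃⇒≐ (intertwine-⁻¹ (x ⋆) (r ⋆) (simple n f (dual A) (mirrorWall s)) (begin
      x ⋆ ∙ r ⋆                  ≈⟨ ≃-sym (⋆-anti-homo r x) ⟩
      (r ∙ x) ⋆                  ≈⟨ ⋆-cong (≐⇒≃ (r ∙ x) (x ∙ simple n f A s) rx≐xs) ⟩
      (x ∙ simple n f A s) ⋆     ≈⟨ ⋆-anti-homo x (simple n f A s) ⟩
      simple n f A s ⋆ ∙ x ⋆     ≈⟨ ∙-congʳ (x ⋆) (⋆-simple A s) ⟩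
      simple n f (dual A) (mirrorWall s) ∙ x ⋆ ∎))
    where open SetoidReasoning W̃-setoid

  BruhatWa⇒InWa : ∀ {A u v} → BruhatWa n f A u v → InWa n f A v
  BruhatWa⇒InWa {A} {u} {v} (bruhat-refl u∈Wa u≐v) = InWa-resp A (≐⇒≃ u v u≐v) u∈Wa
  BruhatWa⇒InWa {A} {v = w} (bruhat-step {v = v} u≤v (r , r-refl , w≐vr , _)) =
    InWa-resp A (≃-sym (≐⇒≃ w (v ∙ r) w≐vr)) (InWa-∙ A v r (BruhatWa⇒InWa u≤v) (IsRefl⇒InWa A r r-refl))

  module _ {A B : Base} (F : Elt n f → Elt n f)
           (F-HasLen : ∀ x ℓ → HasLen n f A x ℓ → HasLen n f B (F x) ℓ)
           (F-HasLen⁻ : ∀ x ℓ → HasLen n f B (F x) ℓ → HasLen n f A x ℓ) where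

    Shorter-map : ∀ u w → Shorter n f A u w → Shorter n f B (F u) (F w)
    Shorter-map u w (ℓ , u-len , w-longer) = ℓ , F-HasLen u ℓ u-len , λ m m≤ℓ → w-longer m m≤ℓ ∘ F-HasLen⁻ w m

  module _ {A B : Base} (F : Elt n f → Elt n f) (F-cong : ∀ {x y} → x ≃ y → F x ≃ F y)
           (F-InWa : ∀ x → InWa n f A x → InWa n f B (F x))
           (F-Step : ∀ v w → InWa n f A v → Step n f A v w → Step n f B (F v) (F w)) where

    BruhatWa-map : ∀ {u v} → BruhatWa n f A u v → BruhatWa n f B (F u) (F v)
    BruhatWa-map {u} {v} (bruhat-refl u∈Wa u≐v) = bruhat-refl (F-InWa u u∈Wa) (≃⇒≐ (F-cong (≐⇒≃ u v u≐v)))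
    BruhatWa-map (bruhat-step {v = v} {w} u≤v v→w) = bruhat-step (BruhatWa-map u≤v) (F-Step v w (BruhatWa⇒InWa u≤v) v→w)

  HasLen-⋆⁻ : ∀ A x ℓ → HasLen n f (dual A) (x ⋆) ℓ → HasLen n f A x ℓ
  HasLen-⋆⁻ A x ℓ h = HasLen-resp A ℓ (⋆-involutive x)
    (subst (λ B → HasLen n f B (x ⋆ ⋆) ℓ) (dual-involutive A) (Star.F-HasLen (dual A) (x ⋆) ℓ h))

  Step-⋆ : ∀ A v w → InWa n f A v → Step n f A v w → Step n f (dual A) (v ⋆) (w ⋆)
  Step-⋆ A v w v∈Wa (r , r-refl , w≐vr , v<w) =
    v ⋆ ⁻¹ ∙ r ⋆ ∙ v ⋆ , IsRefl-conj (dual A) (r ⋆) (v ⋆) (Star.F-InWa A v v∈Wa) (IsRefl-⋆ A r r-refl) , ≃⇒≐ w⋆≃ ,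
    Shorter-map _⋆ (Star.F-HasLen A) (HasLen-⋆⁻ A) v w v<w
    where
    open SetoidReasoning W̃-setoid
    w⋆≃ : w ⋆ ≃ v ⋆ ∙ (v ⋆ ⁻¹ ∙ r ⋆ ∙ v ⋆)
    w⋆≃ = begin
      w ⋆                        ≈⟨ ⋆-cong (≐⇒≃ w (v ∙ r) w≐vr) ⟩
      (v ∙ r) ⋆                  ≈⟨ ⋆-anti-homo v r ⟩
      r ⋆ ∙ v ⋆                  ≈⟨ ≃-sym (\\-leftDividesˡ (v ⋆) (r ⋆ ∙ v ⋆)) ⟩
      v ⋆ ∙ (v ⋆ ⁻¹ ∙ (r ⋆ ∙ v ⋆)) ≈⟨ ∙-congˡ (v ⋆) (≃-sym (∙-assoc (v ⋆ ⁻¹) (r ⋆) (v ⋆))) ⟩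
      v ⋆ ∙ (v ⋆ ⁻¹ ∙ r ⋆ ∙ v ⋆) ∎

  BruhatWa-⋆ : ∀ {A u v} → BruhatWa n f A u v → BruhatWa n f (dual A) (u ⋆) (v ⋆)
  BruhatWa-⋆ {A} = BruhatWa-map _⋆ ⋆-cong (Star.F-InWa A) (Step-⋆ A)

  NormalisesSimple : Base → Elt n f → Set
  NormalisesSimple A g = ∀ s → Σ (Wall n f) λ s′ → g ∙ simple n f A s ≃ simple n f A s′ ∙ g

  module Conjugation (A : Base) (h : Elt n f) (h-normalises : NormalisesSimple A h) where

    conj : Elt n f → Elt n f
    conj z = h ∙ z ∙ h ⁻¹

    conj-cong : ∀ {x y} → x ≃ y → conj x ≃ conj y
    conj-cong x≃y = ∙-congʳ (h ⁻¹) (∙-congˡ h x≃y)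

    conj-homo : ∀ x y → conj (x ∙ y) ≃ conj x ∙ conj y
    conj-homo x y = begin
      h ∙ (x ∙ y) ∙ h ⁻¹                 ≈⟨ ∙-congʳ (h ⁻¹) (≃-sym (∙-assoc h x y)) ⟩
      h ∙ x ∙ y ∙ h ⁻¹                   ≈⟨ ∙-congʳ (h ⁻¹) (∙-congʳ y (≃-sym (//-rightDividesˡ h (h ∙ x)))) ⟩
      h ∙ x ∙ h ⁻¹ ∙ h ∙ y ∙ h ⁻¹        ≈⟨ ∙-congʳ (h ⁻¹) (∙-assoc (conj x) h y) ⟩
      conj x ∙ (h ∙ y) ∙ h ⁻¹            ≈⟨ ∙-assoc (conj x) (h ∙ y) (h ⁻¹) ⟩
      conj x ∙ conj y                    ∎
      where open SetoidReasoning W̃-setoid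

    conj-ε : conj ε ≃ ε
    conj-ε = ≃-trans (∙-congʳ (h ⁻¹) (∙-identityʳ h)) (∙-inverseʳ h)

    conj-simple : ∀ s → conj (simple n f A s) ≃ simple n f A (proj₁ (h-normalises s))
    conj-simple s = ≃-trans (∙-congʳ (h ⁻¹) (proj₂ (h-normalises s))) (//-rightDividesʳ h _)

    open SimpleHom conj conj-cong conj-homo conj-ε A A (proj₁ ∘ h-normalises) conj-simple public

  conj-cancel : ∀ h z → h ⁻¹ ∙ (h ∙ z ∙ h ⁻¹) ∙ h ⁻¹ ⁻¹ ≃ z
  conj-cancel h z = begin
    h ⁻¹ ∙ (h ∙ z ∙ h ⁻¹) ∙ h ⁻¹ ⁻¹   ≈⟨ ∙-congˡ (h ⁻¹ ∙ (h ∙ z ∙ h ⁻¹)) (⁻¹-involutive h) ⟩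
    h ⁻¹ ∙ (h ∙ z ∙ h ⁻¹) ∙ h         ≈⟨ ∙-congʳ h (∙-congˡ (h ⁻¹) (∙-assoc h z (h ⁻¹))) ⟩
    h ⁻¹ ∙ (h ∙ (z ∙ h ⁻¹)) ∙ h       ≈⟨ ∙-congʳ h (\\-leftDividesʳ h (z ∙ h ⁻¹)) ⟩
    z ∙ h ⁻¹ ∙ h                      ≈⟨ //-rightDividesˡ h z ⟩
    z                                 ∎
    where open SetoidReasoning W̃-setoid

  module _ (A : Base) (g : Elt n f) (g-normalises : NormalisesSimple A g) (g⁻¹-normalises : NormalisesSimple A (g ⁻¹)) where
    open Conjugation A g g-normalises
    private module C⁻ = Conjugation A (g ⁻¹) g⁻¹-normalises

    HasLen-conj⁻ : ∀ x ℓ → HasLen n f A (conj x) ℓ → HasLen n f A x ℓ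
    HasLen-conj⁻ x ℓ h = HasLen-resp A ℓ (conj-cancel g x) (C⁻.F-HasLen (conj x) ℓ h)

    Step-conj : ∀ v w → InWa n f A v → Step n f A v w → Step n f A (conj v) (conj w)
    Step-conj v w _ (r , r-refl , w≐vr , v<w) =
      conj r , F-IsRefl r r-refl , ≃⇒≐ (≃-trans (conj-cong (≐⇒≃ w (v ∙ r) w≐vr)) (conj-homo v r)) ,
      Shorter-map conj F-HasLen HasLen-conj⁻ v w v<w

    BruhatWa-conj : ∀ {u v} → BruhatWa n f A u v → BruhatWa n f A (conj u) (conj v)
    BruhatWa-conj = BruhatWa-map conj conj-cong F-InWa Step-conj

-- Alcoves and the group Ω

-- The embedding ℤ → ℚ in the form in which act uses it.
ι : ℤ → ℚ
ι a = a / 1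

ι≡mkℚ : ∀ a → ι a ≡ mkℚ a 0 (Coprimality.sym (1-coprimeTo ℤ.∣ a ∣))
ι≡mkℚ a = ℚ.↥p/↧p≡p _

ι-homo-+ : ∀ a b → ι (a ℤ.+ b) ≡ ι a ℚ.+ ι b
ι-homo-+ a b = ℚ.toℚᵘ-injective (ℚᵘ.≃-trans lhs (ℚᵘ.≃-sym (ℚ.toℚᵘ-homo-+ (ι a) (ι b))))
  where
  open ℤ-Solver
  lhs : ℚ.toℚᵘ (ι (a ℤ.+ b)) ℚᵘ.≃ ℚ.toℚᵘ (ι a) ℚᵘ.+ ℚ.toℚᵘ (ι b)
  lhs rewrite ι≡mkℚ (a ℤ.+ b) | ι≡mkℚ a | ι≡mkℚ b =
    ℚᵘ.*≡* (solve 2 (λ x y → (x :+ y) :* con (+ 1) := (x :* con (+ 1) :+ y :* con (+ 1)) :* con (+ 1)) refl a b)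

ι-homo-neg : ∀ a → ι (ℤ.- a) ≡ ℚ.- ι a
ι-homo-neg a = ℚ.toℚᵘ-injective (ℚᵘ.≃-trans lhs (ℚᵘ.≃-sym (ℚ.toℚᵘ-homo‿- (ι a))))
  where
  lhs : ℚ.toℚᵘ (ι (ℤ.- a)) ℚᵘ.≃ ℚᵘ.- ℚ.toℚᵘ (ι a)
  lhs rewrite ι≡mkℚ (ℤ.- a) | ι≡mkℚ a = ℚᵘ.*≡* refl

ι-homo-sub : ∀ a b → ι (a ℤ.- b) ≡ ι a ℚ.- ι b
ι-homo-sub a b = trans (ι-homo-+ a (ℤ.- b)) (cong (ι a ℚ.+_) (ι-homo-neg b))

ι-mono-< : ∀ {a b} → a ℤ.< b → ι a ℚ.< ι b
ι-mono-< {a} {b} a<b rewrite ι≡mkℚ a | ι≡mkℚ b = ℚ.*<* (subst₂ ℤ._<_ (sym (ℤ.*-identityʳ a)) (sym (ℤ.*-identityʳ b)) a<b)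

ι-mono-≤ : ∀ {a b} → a ℤ.≤ b → ι a ℚ.≤ ι b
ι-mono-≤ {a} {b} a≤b rewrite ι≡mkℚ a | ι≡mkℚ b = ℚ.*≤* (subst₂ ℤ._≤_ (sym (ℤ.*-identityʳ a)) (sym (ℤ.*-identityʳ b)) a≤b)

ι-cancel-< : ∀ {a b} → ι a ℚ.< ι b → a ℤ.< b
ι-cancel-< {a} {b} ιa<ιb rewrite ι≡mkℚ a | ι≡mkℚ b with ιa<ιb
... | ℚ.*<* a<b = subst₂ ℤ._<_ (ℤ.*-identityʳ a) (ℤ.*-identityʳ b) a<b

ι-squeeze : ∀ d e → ι (e ℤ.- + 1) ℚ.< ι d → ι d ℚ.< ι (e ℤ.+ + 1) → d ≡ e
ι-squeeze d e e-1<d d<e+1 = ℤ.≤-antisym d≤e e≤d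
  where
  open ℤ-Solver
  e≤d : e ℤ.≤ d
  e≤d = subst (ℤ._≤ d) (solve 1 (λ x → con (+ 1) :+ (x :- con (+ 1)) := x) refl e) (ℤ.i<j⇒suc[i]≤j (ι-cancel-< {e ℤ.- + 1} {d} e-1<d))
  d≤e : d ℤ.≤ e
  d≤e = ℤ.neg-cancel-≤ (subst (ℤ._≤ ℤ.- d) (solve 1 (λ x → con (+ 1) :+ (:- (x :+ con (+ 1))) := :- x) refl e)
                         (ℤ.i<j⇒suc[i]≤j (ℤ.neg-mono-< (ι-cancel-< {d} {e ℤ.+ + 1} d<e+1))))

shifted-difference-sub : ∀ p q x y → ((p ℚ.+ x) ℚ.- (q ℚ.+ y)) ℚ.- (p ℚ.- q) ≡ x ℚ.- y
shifted-difference-sub = solve 4 (λ p q x y → ((p :+ x) :- (q :+ y)) :- (p :- q) := x :- y) refl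
  where open ℚ-Solver

shifted-difference-add : ∀ p q x y → ((q ℚ.+ y) ℚ.- (p ℚ.+ x)) ℚ.+ (p ℚ.- q) ≡ y ℚ.- x
shifted-difference-add = solve 4 (λ p q x y → ((q :+ y) :- (p :+ x)) :+ (p :- q) := y :- x) refl
  where open ℚ-Solver

-- Both differences lie in (L, U) with U - L = 1, so the integer a - b lies in (-1, 1).
shift-in-unit-interval : ∀ (a b : ℤ) (p q L U : ℚ) →
  L ℚ.< (p ℚ.+ ι a) ℚ.- (q ℚ.+ ι b) → (p ℚ.+ ι a) ℚ.- (q ℚ.+ ι b) ℚ.< U →
  L ℚ.< p ℚ.- q → p ℚ.- q ℚ.< U →
  L ℚ.- U ≡ ι (ℤ.- + 1) → U ℚ.- L ≡ ι (+ 1) → a ≡ b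
shift-in-unit-interval a b p q L U L<y y<U L<x x<U L-U≡-1 U-L≡1 =
  ℤ.i-j≡0⇒i≡j a b (ι-squeeze (a ℤ.- b) (+ 0)
    (subst₂ ℚ._<_ L-U≡-1 y-x≡ (ℚ.+-mono-< L<y (ℚ.neg-antimono-< x<U)))
    (subst₂ ℚ._<_ y-x≡ U-L≡1 (ℚ.+-mono-< y<U (ℚ.neg-antimono-< L<x))))
  where
  y-x≡ : ((p ℚ.+ ι a) ℚ.- (q ℚ.+ ι b)) ℚ.- (p ℚ.- q) ≡ ι (a ℤ.- b)
  y-x≡ = trans (shifted-difference-sub p q (ι a) (ι b)) (sym (ι-homo-sub a b))

-- Adding the two differences cancels p - q, so the integer b - a lies in (2L, 2U) = (e - 1, e + 1).
reflected-shift-in-interval : ∀ (a b e : ℤ) (p q L U : ℚ) →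
  L ℚ.< (q ℚ.+ ι b) ℚ.- (p ℚ.+ ι a) → (q ℚ.+ ι b) ℚ.- (p ℚ.+ ι a) ℚ.< U →
  L ℚ.< p ℚ.- q → p ℚ.- q ℚ.< U →
  L ℚ.+ L ≡ ι (e ℤ.- + 1) → U ℚ.+ U ≡ ι (e ℤ.+ + 1) → b ≡ a ℤ.+ e
reflected-shift-in-interval a b e p q L U L<y y<U L<x x<U 2L≡ 2U≡ =
  trans (sym (solve 2 (λ x y → y :+ (x :- y) := x) refl b a))
        (cong (λ d → a ℤ.+ d) (ι-squeeze (b ℤ.- a) e (subst₂ ℚ._<_ 2L≡ y+x≡ (ℚ.+-mono-< L<y L<x))
                                                      (subst₂ ℚ._<_ y+x≡ 2U≡ (ℚ.+-mono-< y<U x<U))))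
  where
  open ℤ-Solver
  y+x≡ : ((q ℚ.+ ι b) ℚ.- (p ℚ.+ ι a)) ℚ.+ (p ℚ.- q) ≡ ι (b ℤ.- a)
  y+x≡ = trans (shifted-difference-add p q (ι a) (ι b)) (sym (ι-homo-sub b a))

lower upper : Base → ℚ
lower dom = 0ℚ
lower antidom = ℚ.- 1ℚ
upper dom = 1ℚ
upper antidom = 0ℚ

module Alcoves (n f : ℕ) where
  open Affine n f

  InAlc⇒bounds : ∀ A p → InAlc n f A p →
    ∀ j a b → a <ᶠ b → (lower A ℚ.< p j a ℚ.- p j b) × (p j a ℚ.- p j b ℚ.< upper A)
  InAlc⇒bounds dom p p∈A = p∈A
  InAlc⇒bounds antidom p p∈A = p∈A

  bounds⇒InAlc : ∀ A p →
    (∀ j a b → a <ᶠ b → (lower A ℚ.< p j a ℚ.- p j b) × (p j a ℚ.- p j b ℚ.< upper A)) → InAlc n f A p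
  bounds⇒InAlc dom p bounds = bounds
  bounds⇒InAlc antidom p bounds = bounds

  InAlc-resp : ∀ A {p q} → (∀ j i → p j i ≡ q j i) → InAlc n f A p → InAlc n f A q
  InAlc-resp A {p} {q} p≗q p∈A = bounds⇒InAlc A q λ j a b a<b →
    subst (λ z → (lower A ℚ.< z) × (z ℚ.< upper A)) (cong₂ ℚ._-_ (p≗q j a) (p≗q j b)) (InAlc⇒bounds A p p∈A j a b a<b)

  mirrorPt : Pt n f → Pt n f
  mirrorPt p j i = ℚ.- p (opposite j) i

  InAlc-mirror : ∀ A q → InAlc n f (dual A) q → InAlc n f A (mirrorPt q)
  InAlc-mirror A q q∈A* = bounds⇒InAlc A (mirrorPt q) λ j a b a<b →
    let (l , u) = InAlc⇒bounds (dual A) q q∈A* (opposite j) a b a<b in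
    subst (λ z → (lower A ℚ.< z) × (z ℚ.< upper A)) (sym (neg-sub (q (opposite j) a) (q (opposite j) b)))
          (subst (ℚ._< _) (neg-upper A) (ℚ.neg-antimono-< u) , subst (_ ℚ.<_) (neg-lower A) (ℚ.neg-antimono-< l))
    where
    neg-sub : ∀ x y → ℚ.- x ℚ.- ℚ.- y ≡ ℚ.- (x ℚ.- y)
    neg-sub = solve 2 (λ x y → (:- x) :- (:- y) := :- (x :- y)) refl
      where open ℚ-Solver
    neg-upper : ∀ A → ℚ.- upper (dual A) ≡ lower A
    neg-upper dom = refl
    neg-upper antidom = refl
    neg-lower : ∀ A → ℚ.- lower (dual A) ≡ upper A
    neg-lower dom = refl
    neg-lower antidom = refl

  mirrorPt-involutive : ∀ q j i → mirrorPt (mirrorPt q) j i ≡ q j i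
  mirrorPt-involutive q j i = trans (neg-involutive _) (cong (λ j′ → q j′ i) (Fin.opposite-involutive j))
    where
    neg-involutive : ∀ x → ℚ.- (ℚ.- x) ≡ x
    neg-involutive = solve 1 (λ x → :- (:- x) := x) refl
      where open ℚ-Solver

  InAlc-mirror⁻ : ∀ A q → InAlc n f A (mirrorPt q) → InAlc n f (dual A) q
  InAlc-mirror⁻ A q q*∈A = InAlc-resp (dual A) (mirrorPt-involutive q)
    (InAlc-mirror (dual A) (mirrorPt q) (subst (λ B → InAlc n f B (mirrorPt q)) (sym (dual-involutive A)) q*∈A))

  act-mirrorPt-⋆ : ∀ ω q j i → act n f ω (mirrorPt (act n f (ω ⋆) q)) j i ≡ mirrorPt q j i
  act-mirrorPt-⋆ ω q j i = cancel (opposite (opposite j)) (Fin.opposite-involutive j)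
    where
    cancel : ∀ j′ → j′ ≡ j → let k = pm ω j′ ⟨$⟩ʳ (pm ω j ⟨$⟩ˡ i) in
      ℚ.- (q (opposite j) k ℚ.+ ι (sh ω j′ k)) ℚ.+ ι (sh ω j i) ≡ ℚ.- q (opposite j) i
    cancel .j refl rewrite inverseʳ (pm ω j) {i} =
      solve 2 (λ a b → (:- (a :+ b)) :+ b := :- a) refl (q (opposite j) i) (ι (sh ω j i))
      where open ℚ-Solver

  act-⁻¹ : ∀ g p j i → act n f g (act n f (g ⁻¹) p) j i ≡ p j i
  act-⁻¹ g p j i rewrite inverseʳ (pm g j) {i} | ι-homo-neg (sh g j i) =
    solve 2 (λ a b → (a :+ (:- b)) :+ b := a) refl (p j i) (ι (sh g j i))
    where open ℚ-Solver

  Ω-⋆ : ∀ A ω → InΩ n f A ω → InΩ n f (dual A) (ω ⋆)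
  Ω-⋆ A ω ω∈Ω q = preserves , reflects
    where
    q′ = act n f (ω ⋆) q
    preserves : InAlc n f (dual A) q → InAlc n f (dual A) q′
    preserves q∈A* = InAlc-mirror⁻ A q′ (proj₂ (ω∈Ω (mirrorPt q′))
      (InAlc-resp A (λ j i → sym (act-mirrorPt-⋆ ω q j i)) (InAlc-mirror A q q∈A*)))
    reflects : InAlc n f (dual A) q′ → InAlc n f (dual A) q
    reflects q′∈A* = InAlc-mirror⁻ A q (InAlc-resp A (act-mirrorPt-⋆ ω q) (proj₁ (ω∈Ω (mirrorPt q′)) (InAlc-mirror A q′ q′∈A*)))

  Ω-⁻¹ : ∀ A g → InΩ n f A g → InΩ n f A (g ⁻¹)
  Ω-⁻¹ A g g∈Ω p = preserves , reflects
    where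
    p′ = act n f (g ⁻¹) p
    preserves : InAlc n f A p → InAlc n f A p′
    preserves p∈A = proj₂ (g∈Ω p′) (InAlc-resp A (λ j i → sym (act-⁻¹ g p j i)) p∈A)
    reflects : InAlc n f A p′ → InAlc n f A p
    reflects p′∈A = InAlc-resp A (act-⁻¹ g p) (proj₁ (g∈Ω p′) p′∈A)

-- Permutations whose shifts jump across descents

module _ {n : ℕ} where

  outside-adjacent : {c c′ d : Fin n} → toℕ c′ ≡ suc (toℕ c) → c ≢ d → c′ ≢ d → d <ᶠ c ⊎ c′ <ᶠ d
  outside-adjacent {c} {c′} {d} adj c≢d c′≢d with Fin.<-cmp d c
  ... | tri< d<c _ _ = inj₁ d<c
  ... | tri≈ _ d≡c _ = ⊥-elim (c≢d (sym d≡c))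
  ... | tri> _ _ c<d = inj₂ (ℕ.≤∧≢⇒< (subst (ℕ._≤ toℕ d) (sym adj) c<d) (c′≢d ∘ Fin.toℕ-injective))

module _ {m : ℕ} where

  strictly-inside : {a b d : Fin (suc m)} → toℕ a ≡ 0 → toℕ b ≡ m → a ≢ d → b ≢ d → a <ᶠ d × d <ᶠ b
  strictly-inside {a} {b} {d} a≡0 b≡m a≢d b≢d =
    subst (ℕ._< toℕ d) (sym a≡0) (ℕ.n≢0⇒n>0 λ d≡0 → a≢d (Fin.toℕ-injective (trans a≡0 (sym d≡0)))) ,
    subst (toℕ d ℕ.<_) (sym b≡m) (ℕ.≤∧≢⇒< (Fin.toℕ≤pred[n] d) λ d≡m → b≢d (Fin.toℕ-injective (trans b≡m (sym d≡m))))

  module PatternAvoiding (w : Permutation′ (suc m)) (N : Fin (suc m) → ℤ) (s : ℤ) (s≢0 : s ≢ + 0)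
    (ascent : ∀ c₁ c₂ → c₁ <ᶠ c₂ → w ⟨$⟩ʳ c₁ <ᶠ w ⟨$⟩ʳ c₂ → N c₁ ≡ N c₂)
    (descent : ∀ c₁ c₂ → c₁ <ᶠ c₂ → w ⟨$⟩ʳ c₂ <ᶠ w ⟨$⟩ʳ c₁ → N c₂ ≡ N c₁ ℤ.+ s) where

    private
      w[_] : Fin (suc m) → Fin (suc m)
      w[ c ] = w ⟨$⟩ʳ c

    +s≢ : ∀ x → x ℤ.+ s ≢ x
    +s≢ x x+s≡x = s≢0 (+-cancelˡ x s (+ 0) (trans x+s≡x (sym (ℤ.+-identityʳ x))))
      where open GroupProperties (AbelianGroup.group ℤ.+-0-abelianGroup) using () renaming (∙-cancelˡ to +-cancelˡ)

    module _ {c₁ c₂ c₃ : Fin (suc m)} (c₁<c₂ : c₁ <ᶠ c₂) (c₂<c₃ : c₂ <ᶠ c₃) where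

      private
        c₁<c₃ : c₁ <ᶠ c₃
        c₁<c₃ = ℕ.<-trans c₁<c₂ c₂<c₃

      no-321 : w[ c₂ ] <ᶠ w[ c₁ ] → w[ c₃ ] <ᶠ w[ c₂ ] → ⊥
      no-321 W₂<W₁ W₃<W₂ = +s≢ (N c₂) (trans (sym (descent c₂ c₃ c₂<c₃ W₃<W₂))
        (trans (descent c₁ c₃ c₁<c₃ (ℕ.<-trans W₃<W₂ W₂<W₁)) (sym (descent c₁ c₂ c₁<c₂ W₂<W₁))))

      no-132 : w[ c₁ ] <ᶠ w[ c₃ ] → w[ c₃ ] <ᶠ w[ c₂ ] → ⊥
      no-132 W₁<W₃ W₃<W₂ = +s≢ (N c₂) (trans (sym (descent c₂ c₃ c₂<c₃ W₃<W₂))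
        (trans (sym (ascent c₁ c₃ c₁<c₃ W₁<W₃)) (ascent c₁ c₂ c₁<c₂ (ℕ.<-trans W₁<W₃ W₃<W₂))))

      no-213 : w[ c₂ ] <ᶠ w[ c₁ ] → w[ c₁ ] <ᶠ w[ c₃ ] → ⊥
      no-213 W₂<W₁ W₁<W₃ = +s≢ (N c₁) (trans (sym (descent c₁ c₂ c₁<c₂ W₂<W₁))
        (trans (ascent c₂ c₃ c₂<c₃ (ℕ.<-trans W₂<W₁ W₁<W₃)) (sym (ascent c₁ c₃ c₁<c₃ W₁<W₃))))

    private
      distinct : ∀ {x y} → w[ x ] <ᶠ w[ y ] → x ≢ y
      distinct Wx<Wy x≡y = Fin.<-irrefl (cong w[_] x≡y) Wx<Wy

      distinct⁻ : ∀ {x y} → w[ x ] <ᶠ w[ y ] → y ≢ x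
      distinct⁻ Wx<Wy = distinct Wx<Wy ∘ sym

      value-at : ∀ v → w[ w ⟨$⟩ˡ v ] ≡ v
      value-at v = inverseʳ w

      value-between : ∀ {x y} → w[ x ] <ᶠ w[ y ] → toℕ w[ y ] ≢ suc (toℕ w[ x ]) →
                      Σ (Fin (suc m)) λ d → w[ x ] <ᶠ w[ d ] × w[ d ] <ᶠ w[ y ]
      value-between {x} {y} Wx<Wy gap =
        w ⟨$⟩ˡ v , subst (λ u → w[ x ] <ᶠ u) (sym (value-at v)) (subst (toℕ w[ x ] ℕ.<_) (sym toℕ-v) (ℕ.n<1+n _)) ,
                   subst (_<ᶠ w[ y ]) (sym (value-at v)) (subst (ℕ._< toℕ w[ y ]) (sym toℕ-v) 1+x<y)
        where
        1+x<y : suc (toℕ w[ x ]) ℕ.< toℕ w[ y ]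
        1+x<y = ℕ.≤∧≢⇒< Wx<Wy (gap ∘ sym)
        v = Fin.fromℕ< (ℕ.<-trans 1+x<y (Fin.toℕ<n w[ y ]))
        toℕ-v : toℕ v ≡ suc (toℕ w[ x ])
        toℕ-v = Fin.toℕ-fromℕ< (ℕ.<-trans 1+x<y (Fin.toℕ<n w[ y ]))

      value-above : ∀ {x} → toℕ w[ x ] ≢ m → Σ (Fin (suc m)) λ d → w[ x ] <ᶠ w[ d ]
      value-above {x} Wx≢m = w ⟨$⟩ˡ Fin.fromℕ m , subst (λ u → w[ x ] <ᶠ u) (sym (value-at (Fin.fromℕ m)))
        (subst (toℕ w[ x ] ℕ.<_) (sym (Fin.toℕ-fromℕ m)) (ℕ.≤∧≢⇒< (Fin.toℕ≤pred[n] w[ x ]) Wx≢m))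

      value-below : ∀ {x} → toℕ w[ x ] ≢ 0 → Σ (Fin (suc m)) λ d → w[ d ] <ᶠ w[ x ]
      value-below {x} Wx≢0 = w ⟨$⟩ˡ Fin.zero , subst (_<ᶠ w[ x ]) (sym (value-at Fin.zero)) (ℕ.n≢0⇒n>0 Wx≢0)

    module _ {c c′ : Fin (suc m)} (adj : toℕ c′ ≡ suc (toℕ c)) where

      private
        c<c′ : c <ᶠ c′
        c<c′ = subst (toℕ c ℕ.<_) (sym adj) (ℕ.n<1+n _)

      adjacent-ascent : w[ c ] <ᶠ w[ c′ ] → toℕ w[ c′ ] ≡ suc (toℕ w[ c ])
      adjacent-ascent Wc<Wc′ with toℕ w[ c′ ] ℕ.≟ suc (toℕ w[ c ])
      ... | yes eq = eq
      ... | no gap with value-between Wc<Wc′ gap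
      ...   | d , Wc<Wd , Wd<Wc′ with outside-adjacent adj (distinct Wc<Wd) (distinct⁻ Wd<Wc′)
      ...     | inj₁ d<c = ⊥-elim (no-213 d<c c<c′ Wc<Wd Wd<Wc′)
      ...     | inj₂ c′<d = ⊥-elim (no-132 c<c′ c′<d Wc<Wd Wd<Wc′)

      adjacent-descent-top : w[ c′ ] <ᶠ w[ c ] → toℕ w[ c ] ≡ m
      adjacent-descent-top Wc′<Wc with toℕ w[ c ] ℕ.≟ m
      ... | yes eq = eq
      ... | no Wc≢m with value-above Wc≢m
      ...   | d , Wc<Wd with outside-adjacent adj (distinct Wc<Wd) (distinct (ℕ.<-trans Wc′<Wc Wc<Wd))
      ...     | inj₁ d<c = ⊥-elim (no-321 d<c c<c′ Wc<Wd Wc′<Wc)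
      ...     | inj₂ c′<d = ⊥-elim (no-213 c<c′ c′<d Wc′<Wc Wc<Wd)

      adjacent-descent-bottom : w[ c′ ] <ᶠ w[ c ] → toℕ w[ c′ ] ≡ 0
      adjacent-descent-bottom Wc′<Wc with toℕ w[ c′ ] ℕ.≟ 0
      ... | yes eq = eq
      ... | no Wc′≢0 with value-below Wc′≢0
      ...   | d , Wd<Wc′ with outside-adjacent adj (distinct⁻ (ℕ.<-trans Wd<Wc′ Wc′<Wc)) (distinct⁻ Wd<Wc′)
      ...     | inj₁ d<c = ⊥-elim (no-132 d<c c<c′ Wd<Wc′ Wc′<Wc)
      ...     | inj₂ c′<d = ⊥-elim (no-321 c<c′ c′<d Wc′<Wc Wd<Wc′)

    module _ {a b : Fin (suc m)} (a≡0 : toℕ a ≡ 0) (b≡m : toℕ b ≡ m) where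

      ends-ascent-bottom : w[ a ] <ᶠ w[ b ] → toℕ w[ a ] ≡ 0
      ends-ascent-bottom Wa<Wb with toℕ w[ a ] ℕ.≟ 0
      ... | yes eq = eq
      ... | no Wa≢0 with value-below Wa≢0
      ...   | d , Wd<Wa with strictly-inside a≡0 b≡m (distinct⁻ Wd<Wa) (distinct⁻ (ℕ.<-trans Wd<Wa Wa<Wb))
      ...     | a<d , d<b = ⊥-elim (no-213 a<d d<b Wd<Wa Wa<Wb)

      ends-ascent-top : w[ a ] <ᶠ w[ b ] → toℕ w[ b ] ≡ m
      ends-ascent-top Wa<Wb with toℕ w[ b ] ℕ.≟ m
      ... | yes eq = eq
      ... | no Wb≢m with value-above Wb≢m
      ...   | d , Wb<Wd with strictly-inside a≡0 b≡m (distinct (ℕ.<-trans Wa<Wb Wb<Wd)) (distinct Wb<Wd)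
      ...     | a<d , d<b = ⊥-elim (no-132 a<d d<b Wa<Wb Wb<Wd)

      ends-descent : w[ b ] <ᶠ w[ a ] → toℕ w[ a ] ≡ suc (toℕ w[ b ])
      ends-descent Wb<Wa with toℕ w[ a ] ℕ.≟ suc (toℕ w[ b ])
      ... | yes eq = eq
      ... | no gap with value-between Wb<Wa gap
      ...   | d , Wb<Wd , Wd<Wa with strictly-inside a≡0 b≡m (distinct⁻ Wd<Wa) (distinct Wb<Wd)
      ...     | a<d , d<b = ⊥-elim (no-321 a<d d<b Wd<Wa Wb<Wd)

-- Elements of Ω normalise the simple reflections

module Normaliser (k f : ℕ) where

  private
    n = suc (suc k)

  open Affine n f
  open Alcoves n f

  lower-upper : ∀ A → lower A ℚ.- upper A ≡ ι (ℤ.- + 1)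
  lower-upper dom = refl
  lower-upper antidom = refl

  upper-lower : ∀ A → upper A ℚ.- lower A ≡ ι (+ 1)
  upper-lower dom = refl
  upper-lower antidom = refl

  lower+lower : ∀ A → lower A ℚ.+ lower A ≡ ι (affConst n f A ℤ.- + 1)
  lower+lower dom = refl
  lower+lower antidom = refl

  upper+upper : ∀ A → upper A ℚ.+ upper A ≡ ι (affConst n f A ℤ.+ + 1)
  upper+upper dom = refl
  upper+upper antidom = refl

  affConst≢0 : ∀ A → affConst n f A ≢ + 0
  affConst≢0 dom ()
  affConst≢0 antidom ()

  1/n : ℚ
  1/n = mkℚ (+ 1) (suc k) (1-coprimeTo n)

  infix 9 _/n
  _/n : ℕ → ℚ
  c /n = ι (+ c) ℚ.* 1/n

  n/n≡1 : n /n ≡ 1ℚ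
  n/n≡1 = ℚ.toℚᵘ-injective (ℚᵘ.≃-trans (ℚ.toℚᵘ-homo-* (ι (+ n)) 1/n) n*1/n≃1)
    where
    n*1/n≃1 : ℚ.toℚᵘ (ι (+ n)) ℚᵘ.* ℚ.toℚᵘ 1/n ℚᵘ.≃ ℚ.toℚᵘ 1ℚ
    n*1/n≃1 rewrite ι≡mkℚ (+ n) = ℚᵘ.*≡* (trans (ℤ.*-identityʳ _) (trans (cong (λ z → + suc (suc z)) (ℕ.*-identityʳ k))
      (sym (trans (ℤ.*-identityˡ _) (cong (λ z → + suc (suc z)) (ℕ.+-identityʳ k))))))

  /n-mono-< : ∀ {a b} → a ℕ.< b → a /n ℚ.< b /n
  /n-mono-< a<b = ℚ.*-monoˡ-<-pos 1/n (ι-mono-< (ℤ.+<+ a<b))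

  /n-nonNeg : ∀ a → 0ℚ ℚ.≤ a /n
  /n-nonNeg a = subst (ℚ._≤ a /n) (ℚ.*-zeroˡ 1/n) (ℚ.*-monoʳ-≤-nonNeg 1/n (ι-mono-≤ {+ 0} {+ a} (ℤ.+≤+ z≤n)))

  /n-gap : ∀ a b → a ℕ.< b → b ℕ.< n → (0ℚ ℚ.< b /n ℚ.- a /n) × (b /n ℚ.- a /n ℚ.< 1ℚ)
  /n-gap a b a<b b<n =
    subst (ℚ._< b /n ℚ.- a /n) (ℚ.+-inverseʳ (a /n)) (ℚ.+-monoˡ-< (ℚ.- a /n) (/n-mono-< a<b)) ,
    ℚ.≤-<-trans (subst (b /n ℚ.- a /n ℚ.≤_) (ℚ.+-identityʳ (b /n)) (ℚ.+-monoʳ-≤ (b /n) (ℚ.neg-antimono-≤ (/n-nonNeg a))))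
                (subst (b /n ℚ.<_) n/n≡1 (/n-mono-< b<n))

  basePt : Base → Pt n f
  basePt dom j c = ℚ.- (toℕ c /n)
  basePt antidom j c = toℕ c /n

  basePt-bounds : ∀ A j (a b : Fin n) → a <ᶠ b →
    (lower A ℚ.< basePt A j a ℚ.- basePt A j b) × (basePt A j a ℚ.- basePt A j b ℚ.< upper A)
  basePt-bounds dom j a b a<b =
    subst (λ z → (0ℚ ℚ.< z) × (z ℚ.< 1ℚ)) (sym (neg-sub-neg (toℕ a /n) (toℕ b /n))) (/n-gap (toℕ a) (toℕ b) a<b (Fin.toℕ<n b))
    where
    neg-sub-neg : ∀ x y → ℚ.- x ℚ.- ℚ.- y ≡ y ℚ.- x
    neg-sub-neg = solve 2 (λ x y → (:- x) :- (:- y) := y :- x) refl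
      where open ℚ-Solver
  basePt-bounds antidom j a b a<b =
    subst (λ z → (ℚ.- 1ℚ ℚ.< z) × (z ℚ.< 0ℚ)) (sym (sub-flip (toℕ a /n) (toℕ b /n)))
          (ℚ.neg-antimono-< (proj₂ gap) , ℚ.neg-antimono-< (proj₁ gap))
    where
    gap = /n-gap (toℕ a) (toℕ b) a<b (Fin.toℕ<n b)
    sub-flip : ∀ x y → x ℚ.- y ≡ ℚ.- (y ℚ.- x)
    sub-flip = solve 2 (λ x y → x :- y := :- (y :- x)) refl
      where open ℚ-Solver

  basePt∈A : ∀ A → InAlc n f A (basePt A)
  basePt∈A A = bounds⇒InAlc A (basePt A) (basePt-bounds A)

  module ShiftProfile (A : Base) (g : Elt n f) (g∈Ω : InΩ n f A g) (j : Fin f) where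

    private
      w = pm g j
      moved = act n f g (basePt A)

    N : Fin n → ℤ
    N c = sh g j (w ⟨$⟩ʳ c)

    private
      moved-at : ∀ c → moved j (w ⟨$⟩ʳ c) ≡ basePt A j c ℚ.+ ι (N c)
      moved-at c = cong (λ z → basePt A j z ℚ.+ ι (N c)) (inverseˡ w)

      moved-bounds : ∀ c₁ c₂ → w ⟨$⟩ʳ c₁ <ᶠ w ⟨$⟩ʳ c₂ →
        (lower A ℚ.< (basePt A j c₁ ℚ.+ ι (N c₁)) ℚ.- (basePt A j c₂ ℚ.+ ι (N c₂))) ×
        ((basePt A j c₁ ℚ.+ ι (N c₁)) ℚ.- (basePt A j c₂ ℚ.+ ι (N c₂)) ℚ.< upper A)
      moved-bounds c₁ c₂ wc₁<wc₂ = subst (λ z → (lower A ℚ.< z) × (z ℚ.< upper A)) (cong₂ ℚ._-_ (moved-at c₁) (moved-at c₂))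
        (InAlc⇒bounds A moved (proj₁ (g∈Ω (basePt A)) (basePt∈A A)) j _ _ wc₁<wc₂)

    ascent : ∀ c₁ c₂ → c₁ <ᶠ c₂ → w ⟨$⟩ʳ c₁ <ᶠ w ⟨$⟩ʳ c₂ → N c₁ ≡ N c₂
    ascent c₁ c₂ c₁<c₂ wc₁<wc₂ =
      shift-in-unit-interval (N c₁) (N c₂) (basePt A j c₁) (basePt A j c₂) (lower A) (upper A)
        (proj₁ shifted) (proj₂ shifted) (proj₁ base) (proj₂ base) (lower-upper A) (upper-lower A)
      where
      shifted = moved-bounds c₁ c₂ wc₁<wc₂
      base = basePt-bounds A j c₁ c₂ c₁<c₂

    descent : ∀ c₁ c₂ → c₁ <ᶠ c₂ → w ⟨$⟩ʳ c₂ <ᶠ w ⟨$⟩ʳ c₁ → N c₂ ≡ N c₁ ℤ.+ affConst n f A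
    descent c₁ c₂ c₁<c₂ wc₂<wc₁ =
      reflected-shift-in-interval (N c₁) (N c₂) (affConst n f A) (basePt A j c₁) (basePt A j c₂) (lower A) (upper A)
        (proj₁ shifted) (proj₂ shifted) (proj₁ base) (proj₂ base) (lower+lower A) (upper+upper A)
      where
      shifted = moved-bounds c₂ c₁ wc₂<wc₁
      base = basePt-bounds A j c₁ c₂ c₁<c₂

    open PatternAvoiding w N (affConst n f A) (affConst≢0 A) ascent descent public

  Ω-normalises-simple : ∀ A g → InΩ n f A g → NormalisesSimple A g
  Ω-normalises-simple A g g∈Ω (inner j c c′ adj) = by-cases (Fin.<-cmp (pm g j ⟨$⟩ʳ c) (pm g j ⟨$⟩ʳ c′))
    where
    open ShiftProfile A g g∈Ω j
    c<c′ : c <ᶠ c′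
    c<c′ = subst (toℕ c ℕ.<_) (sym adj) (ℕ.n<1+n _)
    by-cases : Tri (pm g j ⟨$⟩ʳ c <ᶠ pm g j ⟨$⟩ʳ c′) (pm g j ⟨$⟩ʳ c ≡ pm g j ⟨$⟩ʳ c′) (pm g j ⟨$⟩ʳ c′ <ᶠ pm g j ⟨$⟩ʳ c) →
               Σ (Wall n f) λ s′ → g ∙ simple n f A (inner j c c′ adj) ≃ simple n f A s′ ∙ g
    by-cases (tri< wc<wc′ _ _) = inner j _ _ (adjacent-ascent adj wc<wc′) ,
      reflection-conj-ascent g j c c′ (+ 0) (Fin.<⇒≢ c<c′) (ascent c c′ c<c′ wc<wc′)
    by-cases (tri≈ _ wc≡wc′ _) = ⊥-elim (Fin.<⇒≢ c<c′ (⟨$⟩ʳ-injective (pm g j) wc≡wc′))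
    by-cases (tri> _ _ wc′<wc) = outer j _ _ (adjacent-descent-bottom adj wc′<wc) (adjacent-descent-top adj wc′<wc) ,
      reflection-conj-descent g j c c′ (+ 0) (affConst n f A) (affConst n f A) (ℤ.+-identityʳ (affConst n f A)) (Fin.<⇒≢ c<c′) (descent c c′ c<c′ wc′<wc)
  Ω-normalises-simple A g g∈Ω (outer j a b a≡0 b≡m) = by-cases (Fin.<-cmp (pm g j ⟨$⟩ʳ a) (pm g j ⟨$⟩ʳ b))
    where
    open ShiftProfile A g g∈Ω j
    a<b : a <ᶠ b
    a<b = subst₂ ℕ._<_ (sym a≡0) (sym b≡m) (s≤s z≤n)
    by-cases : Tri (pm g j ⟨$⟩ʳ a <ᶠ pm g j ⟨$⟩ʳ b) (pm g j ⟨$⟩ʳ a ≡ pm g j ⟨$⟩ʳ b) (pm g j ⟨$⟩ʳ b <ᶠ pm g j ⟨$⟩ʳ a) →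
               Σ (Wall n f) λ s′ → g ∙ simple n f A (outer j a b a≡0 b≡m) ≃ simple n f A s′ ∙ g
    by-cases (tri< wa<wb _ _) = outer j _ _ (ends-ascent-bottom a≡0 b≡m wa<wb) (ends-ascent-top a≡0 b≡m wa<wb) ,
      reflection-conj-ascent g j a b (affConst n f A) (Fin.<⇒≢ a<b) (ascent a b a<b wa<wb)
    by-cases (tri≈ _ wa≡wb _) = ⊥-elim (Fin.<⇒≢ a<b (⟨$⟩ʳ-injective (pm g j) wa≡wb))
    by-cases (tri> _ _ wb<wa) = inner j _ _ (ends-descent a≡0 b≡m wb<wa) ,
      reflection-conj-descent g j a b (affConst n f A) (affConst n f A) (+ 0) (ℤ.+-inverseʳ (affConst n f A)) (Fin.<⇒≢ a<b) (descent a b a<b wb<wa)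

-- Duality of the admissible sets

module Duality (k f : ℕ) where

  private
    n = suc (suc k)

  open Affine n f
  open Alcoves n f
  open Normaliser k f

  Bruhat-resp : ∀ A x y x′ y′ → x ≃ x′ → y ≃ y′ → Bruhat n f A x y → Bruhat n f A x′ y′
  Bruhat-resp A x y x′ y′ x≃x′ y≃y′ (u , v , ω , u∈Wa , v∈Wa , ω∈Ω , x≐uω , y≐vω , u≤v) =
    u , v , ω , u∈Wa , v∈Wa , ω∈Ω , ≃⇒≐ (≃-trans (≃-sym x≃x′) (≐⇒≃ x (u ∙ ω) x≐uω)) ,
    ≃⇒≐ (≃-trans (≃-sym y≃y′) (≐⇒≃ y (v ∙ ω) y≐vω)) , u≤v

  Bruhat-⋆ : ∀ A x y → Bruhat n f A x y → Bruhat n f (dual A) (x ⋆) (y ⋆)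
  Bruhat-⋆ A x y (u , v , ω , u∈Wa , v∈Wa , ω∈Ω , x≐uω , y≐vω , u≤v) =
    conj (u ⋆) , conj (v ⋆) , g , F-InWa (u ⋆) (Star.F-InWa A u u∈Wa) , F-InWa (v ⋆) (Star.F-InWa A v v∈Wa) , g∈Ω ,
    ≃⇒≐ (factor x u x≐uω) , ≃⇒≐ (factor y v y≐vω) ,
    BruhatWa-conj (dual A) g g-normalises (Ω-normalises-simple (dual A) (g ⁻¹) (Ω-⁻¹ (dual A) g g∈Ω)) (BruhatWa-⋆ u≤v)
    where
    g : Elt n f
    g = ω ⋆
    g∈Ω : InΩ n f (dual A) g
    g∈Ω = Ω-⋆ A ω ω∈Ω
    g-normalises : NormalisesSimple (dual A) g
    g-normalises = Ω-normalises-simple (dual A) g g∈Ω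
    open Conjugation (dual A) g g-normalises
    factor : ∀ z u → _≐_ n f z (u ∙ ω) → z ⋆ ≃ conj (u ⋆) ∙ g
    factor z u z≐uω = begin
      z ⋆                    ≈⟨ ⋆-cong (≐⇒≃ z (u ∙ ω) z≐uω) ⟩
      (u ∙ ω) ⋆              ≈⟨ ⋆-anti-homo u ω ⟩
      g ∙ u ⋆                ≈⟨ ≃-sym (//-rightDividesˡ g (g ∙ u ⋆)) ⟩
      conj (u ⋆) ∙ g         ∎
      where open SetoidReasoning W̃-setoid


  Adm-⋆ : ∀ A μ x → Adm n f A μ x → Adm n f (dual A) (μ *ˣ) (x ⋆)
  Adm-⋆ A μ x (w′ , x≤) = w″ ,
    Bruhat-resp (dual A) (x ⋆) (t n f (actW n f w′ μ) ⋆) (x ⋆) (t n f (actW n f w″ (μ *ˣ)))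
      (≃-reflexive refl) (≃⁺ (λ _ _ → refl) (λ _ _ → refl)) (Bruhat-⋆ A x (t n f (actW n f w′ μ)) x≤)
    where
    w″ : W n f
    w″ j = w′ (opposite j)

  Adm-⋆⁻ : ∀ A μ x → Adm n f A (μ *ˣ) (x ⋆) → Adm n f (dual A) μ x
  Adm-⋆⁻ A μ x adm = undo (Adm-⋆ A (μ *ˣ) (x ⋆) adm)
    where
    undo : Adm n f (dual A) (μ *ˣ *ˣ) (x ⋆ ⋆) → Adm n f (dual A) μ x
    undo (w′ , x⋆⋆≤) = w′ , Bruhat-resp (dual A) (x ⋆ ⋆) (t n f (actW n f w′ (μ *ˣ *ˣ))) x (t n f (actW n f w′ μ))
      (⋆-involutive x) (≃⁺ (λ j i → cong (λ j′ → μ j′ (w′ j ⟨$⟩ˡ i)) (Fin.opposite-involutive j)) (λ _ _ → refl)) x⋆⋆≤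

lemma2p1p4 : (n f : ℕ) → 2 ≤ n → 1 ≤ f →
    (x : Elt n f) (μ : X* n f) →
    (Adm n f antidom μ x → Adm n f dom (_*X n f μ) (_* n f x)) ×
    (Adm n f dom (_*X n f μ) (_* n f x) → Adm n f antidom μ x)
lemma2p1p4 (suc zero) f (s≤s ()) _ x μ
lemma2p1p4 (suc (suc k)) f _ _ x μ = Adm-⋆ antidom μ x , Adm-⋆⁻ dom μ x
  where open Duality k f
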